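{- Let $T=\{1324,1342,3412\}$. Then \[ F_T(x)=\frac{1-10x+40x^2-81x^3+88x^4-50x^5+11x^6}{(1-x)^3(1-2x)(1-3x)(1-3x+x^2)}. \]
   Context: A permutation $\pi\in S_n$ contains a pattern $\tau\in S_k$ if some subsequence of $\pi$ of length $k$ is order-isomorphic to $\tau$; otherwise $\pi$ avoids $\tau$. For a set $T$ of patterns, $S_n(T)$ denotes the set of permutations of $[n]$ avoiding every pattern in $T$, and $F_T(x)=\sum_{n\ge0}|S_n(T)|x^n$ (with $|S_0(T)|=1$). -}

module Defs where

open import Data.Bool using (Bool; true; false; _∧_; _∨_; not; if_then_else_)
open import Data.Nat using (ℕ; zero; suc; _<ᵇ_)
open import Data.List using (List; []; _∷_; map; concatMap; length; filter; _++_)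
open import Data.Bool.ListAction using (all; any)
open import Data.Fin using (Fin)
open import Data.Integer using (ℤ; +_; -[1+_]; _*_; _+_; -_)
open import Relation.Nullary.Decidable using (Dec; yes; no)
open import Data.Bool.Properties using (T?)
open import Data.Bool using (T)

insertions : ℕ → List ℕ → List (List ℕ)
insertions x []       = (x ∷ []) ∷ []
insertions x (y ∷ ys) = (x ∷ y ∷ ys) ∷ map (y ∷_) (insertions x ys)

-- perms n : the list of all n! permutations of [n] in one-line notation
perms : ℕ → List (List ℕ)
perms zero    = [] ∷ []
perms (suc n) = concatMap (insertions (suc n)) (perms n)

subseqs : ℕ → List ℕ → List (List ℕ)
subseqs zero    _        = [] ∷ []
subseqs (suc k) []       = []
subseqs (suc k) (x ∷ xs) = map (x ∷_) (subseqs k xs) ++ subseqs (suc k) xs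

_==ᵇ_ : Bool → Bool → Bool
true  ==ᵇ b = b
false ==ᵇ b = not b

-- two sequences are order-isomorphic: same length and for all positions
-- i, j:  σ_i < σ_j  iff  τ_i < τ_j
orderIso : List ℕ → List ℕ → Bool
orderIso σ τ = go σ τ
  where
  heads : ℕ → ℕ → List ℕ → List ℕ → Bool
  heads a b []       []       = true
  heads a b (x ∷ xs) (y ∷ ys) =
    ((a <ᵇ x) ==ᵇ (b <ᵇ y)) ∧ ((x <ᵇ a) ==ᵇ (y <ᵇ b)) ∧ heads a b xs ys
  heads a b _        _        = false
  go : List ℕ → List ℕ → Bool
  go []       []       = true
  go (x ∷ xs) (y ∷ ys) = heads x y xs ys ∧ go xs ys
  go _        _        = false

contains : List ℕ → List ℕ → Bool
contains π τ = any (λ s → orderIso s τ) (subseqs (length τ) π)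

avoidsAll : List (List ℕ) → List ℕ → Bool
avoidsAll Tset π = all (λ τ → not (contains π τ)) Tset

countAvoiders : List (List ℕ) → ℕ → ℕ
countAvoiders Tset n = length (filter (λ π → T? (avoidsAll Tset π)) (perms n))

-- Formal power series over ℤ (coefficient functions) and polynomials
-- (coefficient lists, constant term first)

Series : Set
Series = ℕ → ℤ

Poly : Set
Poly = List ℤ

coeff : Poly → ℕ → ℤ
coeff []       _       = + 0
coeff (c ∷ cs) zero    = c
coeff (c ∷ cs) (suc n) = coeff cs n

_·ₚ_ : Poly → Poly → Poly
[]       ·ₚ q = []
(c ∷ cs) ·ₚ q = addP (map (c *_) q) (+ 0 ∷ (cs ·ₚ q))
  where
  addP : Poly → Poly → Poly
  addP []       ys       = ys
  addP xs       []       = xs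
  addP (x ∷ xs) (y ∷ ys) = (x + y) ∷ addP xs ys

sumTo : ℕ → (ℕ → ℤ) → ℤ
sumTo zero    f = f 0
sumTo (suc n) f = sumTo n f + f (suc n)

_·ₛ_ : Poly → Series → Series
(p ·ₛ a) n = sumTo n (λ i → coeff p i * a (n Data.Nat.∸ i))

F : List (List ℕ) → Series
F Tset n = + countAvoiders Tset n

module Submission where

-- Proof by a generating tree.  Combinatorial half: every T-avoider of length
-- n+1 arises from one of length n by inserting the maximum n+1 into a gap,
-- and the result avoids T iff the old permutation does and the gap is
-- *active* (Occurrences, PatternOrder, MaxInsertion).  An avoider is labelled
-- by the flags (above, decreasing) of its active gaps; the labels of its
-- children are determined by its own label (ActiveGaps, Gaps, Labels,
-- LabelRecurrence), and every label that occurs is the image of a state of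
-- an explicit tree with states A j, P a b, Q a (LabelsAreTreeStates).  Hence
-- |S_n(T)| is the number of nodes on level n of that tree.
--
-- Algebraic half: in the ring of formal power series over ℤ (PowerSeries,
-- SeriesToolkit) we attach to each state a series satisfying the tree's
-- functional equation (GeneratingTree), so that it counts the nodes of the
-- subtree level by level (TreeLevels), and solve the resulting linear system
-- for the series of the root (ClosedForm).

open import Defs
open import Data.Nat using (ℕ)
open import Data.List using (List; []; _∷_)
open import Data.Integer using (ℤ; +_; -_)
open import Relation.Binary.PropositionalEquality using (_≡_)

-- Formal power series over ℤ form a commutative ring under pointwise
-- addition and the Cauchy product; the ring bundle lets the library's ring
-- solver normalise series identities.
module PowerSeries where

  open import Data.Nat using (zero; suc)
  open import Data.Integer using (_+_; _*_)
  import Data.Integer.Properties as ℤP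
  open import Data.Integer.Solver using (module +-*-Solver)
  open import Data.Product using (_,_)
  open import Relation.Binary.PropositionalEquality
  open import Relation.Binary.Structures using (IsEquivalence)
  open import Function using (_∘_)
  open import Level using (0ℓ)
  open import Algebra.Bundles using (CommutativeRing)
  open import Algebra.Structures using (IsCommutativeRing)
  open import Algebra.Solver.Ring.AlmostCommutativeRing
    using (fromCommutativeRing; _-Raw-AlmostCommutative⟶_)
  open import Data.Maybe using (Maybe; just; nothing)
  open import Relation.Nullary using (yes; no)
  import Algebra.Solver.Ring as RingSolver

  infix 4 _≈_
  infixl 6 _⊕_
  infixl 7 _⊛_

  _≈_ : Series → Series → Set
  f ≈ g = ∀ n → f n ≡ g n

  _⊕_ : Series → Series → Series
  (f ⊕ g) n = f n + g n

  ⊝_ : Series → Series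
  (⊝ f) n = - f n

  _⊛_ : Series → Series → Series
  (f ⊛ g) zero    = f 0 * g 0
  (f ⊛ g) (suc n) = f 0 * g (suc n) + ((f ∘ suc) ⊛ g) n

  cst : ℤ → Series
  cst c zero    = c
  cst c (suc n) = + 0

  0ₛ 1ₛ : Series
  0ₛ = cst (+ 0)
  1ₛ = cst (+ 1)

  scale : ℤ → Series → Series
  scale c f n = c * f n

  +-interchange : ∀ a b c d → (a + b) + (c + d) ≡ (a + c) + (b + d)
  +-interchange = solve 4 (λ a b c d → (a :+ b) :+ (c :+ d) := (a :+ c) :+ (b :+ d)) refl
    where open +-*-Solver

  ⊛-cong : ∀ {f f′ g g′} → f ≈ f′ → g ≈ g′ → f ⊛ g ≈ f′ ⊛ g′
  ⊛-cong ef eg zero    = cong₂ _*_ (ef 0) (eg 0)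
  ⊛-cong ef eg (suc n) = cong₂ _+_ (cong₂ _*_ (ef 0) (eg (suc n))) (⊛-cong (ef ∘ suc) eg n)

  ⊛-annihilatesˡ : ∀ {f} g → (∀ n → f n ≡ + 0) → ∀ n → (f ⊛ g) n ≡ + 0
  ⊛-annihilatesˡ g f≡0 zero    = cong (_* g 0) (f≡0 0)
  ⊛-annihilatesˡ g f≡0 (suc n) =
    cong₂ _+_ (cong (_* g (suc n)) (f≡0 0)) (⊛-annihilatesˡ g (f≡0 ∘ suc) n)

  0ₛ-coeff : ∀ n → 0ₛ n ≡ + 0
  0ₛ-coeff zero    = refl
  0ₛ-coeff (suc n) = refl

  ⊛-cstˡ : ∀ c g → cst c ⊛ g ≈ scale c g
  ⊛-cstˡ c g zero    = refl
  ⊛-cstˡ c g (suc n) =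
    trans (cong (_+_ (c * g (suc n))) (⊛-annihilatesˡ g (λ _ → refl) n)) (ℤP.+-identityʳ _)

  ⊛-distribʳ : ∀ h f g → (f ⊕ g) ⊛ h ≈ f ⊛ h ⊕ g ⊛ h
  ⊛-distribʳ h f g zero    = ℤP.*-distribʳ-+ (h 0) (f 0) (g 0)
  ⊛-distribʳ h f g (suc n) =
    trans (cong₂ _+_ (ℤP.*-distribʳ-+ (h (suc n)) (f 0) (g 0)) (⊛-distribʳ h (f ∘ suc) (g ∘ suc) n))
          (+-interchange (f 0 * h (suc n)) (g 0 * h (suc n)) (((f ∘ suc) ⊛ h) n) (((g ∘ suc) ⊛ h) n))

  ⊛-distribˡ : ∀ f g h → f ⊛ (g ⊕ h) ≈ f ⊛ g ⊕ f ⊛ h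
  ⊛-distribˡ f g h zero    = ℤP.*-distribˡ-+ (f 0) (g 0) (h 0)
  ⊛-distribˡ f g h (suc n) =
    trans (cong₂ _+_ (ℤP.*-distribˡ-+ (f 0) (g (suc n)) (h (suc n))) (⊛-distribˡ (f ∘ suc) g h n))
          (+-interchange (f 0 * g (suc n)) (f 0 * h (suc n)) (((f ∘ suc) ⊛ g) n) (((f ∘ suc) ⊛ h) n))

  ⊛-scaleˡ : ∀ c f g → scale c f ⊛ g ≈ scale c (f ⊛ g)
  ⊛-scaleˡ c f g zero    = ℤP.*-assoc c (f 0) (g 0)
  ⊛-scaleˡ c f g (suc n) =
    trans (cong₂ _+_ (ℤP.*-assoc c (f 0) (g (suc n))) (⊛-scaleˡ c (f ∘ suc) g n))
          (sym (ℤP.*-distribˡ-+ c _ _))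

  -- the tail of f ⊛ g is  f₀ · (tail g) + (tail f) ⊛ g
  ⊛-assoc : ∀ f g h → (f ⊛ g) ⊛ h ≈ f ⊛ (g ⊛ h)
  ⊛-assoc f g h zero    = ℤP.*-assoc (f 0) (g 0) (h 0)
  ⊛-assoc f g h (suc n) = begin
      f 0 * g 0 * h (suc n) + (((f ⊛ g) ∘ suc) ⊛ h) n
    ≡⟨ cong (_+_ (f 0 * g 0 * h (suc n))) (⊛-distribʳ h (scale (f 0) (g ∘ suc)) ((f ∘ suc) ⊛ g) n) ⟩
      f 0 * g 0 * h (suc n) + ((scale (f 0) (g ∘ suc) ⊛ h) n + (((f ∘ suc) ⊛ g) ⊛ h) n)
    ≡⟨ cong₂ (λ a b → f 0 * g 0 * h (suc n) + (a + b)) (⊛-scaleˡ (f 0) (g ∘ suc) h n) (⊛-assoc (f ∘ suc) g h n) ⟩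
      f 0 * g 0 * h (suc n) + (f 0 * ((g ∘ suc) ⊛ h) n + ((f ∘ suc) ⊛ (g ⊛ h)) n)
    ≡⟨ regroup (f 0) (g 0) (h (suc n)) (((g ∘ suc) ⊛ h) n) (((f ∘ suc) ⊛ (g ⊛ h)) n) ⟩
      f 0 * (g 0 * h (suc n) + ((g ∘ suc) ⊛ h) n) + ((f ∘ suc) ⊛ (g ⊛ h)) n
    ∎
    where
    open ≡-Reasoning
    regroup : ∀ a b c d e → a * b * c + (a * d + e) ≡ a * (b * c + d) + e
    regroup = solve 5 (λ a b c d e → a :* b :* c :+ (a :* d :+ e) := a :* (b :* c :+ d) :+ e) refl
      where open +-*-Solver

  -- commutativity peels one coefficient off each factor in turn
  ⊛-comm : ∀ f g → f ⊛ g ≈ g ⊛ f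
  ⊛-comm f g zero             = ℤP.*-comm (f 0) (g 0)
  ⊛-comm f g (suc zero)       =
    solve 4 (λ a b c d → a :* b :+ c :* d := d :* c :+ b :* a) refl (f 0) (g 1) (f 1) (g 0)
    where open +-*-Solver
  ⊛-comm f g (suc (suc n)) = begin
      f 0 * g (2+ n) + ((f ∘ suc) ⊛ g) (suc n)
    ≡⟨ cong (_+_ (f 0 * g (2+ n))) (⊛-comm (f ∘ suc) g (suc n)) ⟩
      f 0 * g (2+ n) + (g 0 * f (2+ n) + ((g ∘ suc) ⊛ (f ∘ suc)) n)
    ≡⟨ cong (λ z → f 0 * g (2+ n) + (g 0 * f (2+ n) + z)) (⊛-comm (g ∘ suc) (f ∘ suc) n) ⟩
      f 0 * g (2+ n) + (g 0 * f (2+ n) + ((f ∘ suc) ⊛ (g ∘ suc)) n)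
    ≡⟨ swap (f 0 * g (2+ n)) (g 0 * f (2+ n)) (((f ∘ suc) ⊛ (g ∘ suc)) n) ⟩
      g 0 * f (2+ n) + (f 0 * g (2+ n) + ((f ∘ suc) ⊛ (g ∘ suc)) n)
    ≡⟨ cong (_+_ (g 0 * f (2+ n))) (sym (⊛-comm (g ∘ suc) f (suc n))) ⟩
      g 0 * f (2+ n) + ((g ∘ suc) ⊛ f) (suc n)
    ∎
    where
    open ≡-Reasoning
    2+ : ℕ → ℕ
    2+ n = suc (suc n)
    swap : ∀ a b c → a + (b + c) ≡ b + (a + c)
    swap = solve 3 (λ a b c → a :+ (b :+ c) := b :+ (a :+ c)) refl
      where open +-*-Solver

  ⊛-identityˡ : ∀ g → 1ₛ ⊛ g ≈ g
  ⊛-identityˡ g n = trans (⊛-cstˡ (+ 1) g n) (ℤP.*-identityˡ (g n))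

  ⊛-identityʳ : ∀ g → g ⊛ 1ₛ ≈ g
  ⊛-identityʳ g n = trans (⊛-comm g 1ₛ n) (⊛-identityˡ g n)

  ≈-isEquivalence : IsEquivalence _≈_
  ≈-isEquivalence = record
    { refl = λ n → refl ; sym = λ p n → sym (p n) ; trans = λ p q n → trans (p n) (q n) }

  ⊛-isCommutativeRing : IsCommutativeRing _≈_ _⊕_ _⊛_ ⊝_ 0ₛ 1ₛ
  ⊛-isCommutativeRing = record
    { isRing = record
      { +-isAbelianGroup = record
        { isGroup = record
          { isMonoid = record
            { isSemigroup = record
              { isMagma = record
                { isEquivalence = ≈-isEquivalence
                ; ∙-cong = λ p q n → cong₂ _+_ (p n) (q n) }
              ; assoc = λ f g h n → ℤP.+-assoc (f n) (g n) (h n) }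
            ; identity = +-identityˡ , +-identityʳ }
          ; inverse = +-inverseˡ , +-inverseʳ
          ; ⁻¹-cong = λ p n → cong -_ (p n) }
        ; comm = λ f g n → ℤP.+-comm (f n) (g n) }
      ; *-cong = ⊛-cong
      ; *-assoc = ⊛-assoc
      ; *-identity = ⊛-identityˡ , ⊛-identityʳ
      ; distrib = ⊛-distribˡ , ⊛-distribʳ }
    ; *-comm = ⊛-comm }
    where
    +-identityˡ : ∀ f → 0ₛ ⊕ f ≈ f
    +-identityˡ f zero    = ℤP.+-identityˡ (f 0)
    +-identityˡ f (suc n) = ℤP.+-identityˡ (f (suc n))
    +-identityʳ : ∀ f → f ⊕ 0ₛ ≈ f
    +-identityʳ f zero    = ℤP.+-identityʳ (f 0)
    +-identityʳ f (suc n) = ℤP.+-identityʳ (f (suc n))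
    +-inverseˡ : ∀ f → ⊝ f ⊕ f ≈ 0ₛ
    +-inverseˡ f zero    = ℤP.+-inverseˡ (f 0)
    +-inverseˡ f (suc n) = ℤP.+-inverseˡ (f (suc n))
    +-inverseʳ : ∀ f → f ⊕ ⊝ f ≈ 0ₛ
    +-inverseʳ f zero    = ℤP.+-inverseʳ (f 0)
    +-inverseʳ f (suc n) = ℤP.+-inverseʳ (f (suc n))

  seriesRing : CommutativeRing 0ℓ 0ℓ
  seriesRing = record { isCommutativeRing = ⊛-isCommutativeRing }

  -- constants embed ℤ into the series ring; this is what lets the solver
  -- treat integer coefficients as constants
  cst-morphism : CommutativeRing.rawRing ℤP.+-*-commutativeRing
                   -Raw-AlmostCommutative⟶ fromCommutativeRing seriesRing
  cst-morphism = record
    { ⟦_⟧    = cst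
    ; +-homo = λ { a b zero → refl ; a b (suc n) → refl }
    ; *-homo = λ { a b zero → refl
                 ; a b (suc n) → sym (trans (⊛-cstˡ a (cst b) (suc n)) (ℤP.*-zeroʳ a)) }
    ; -‿homo = λ { a zero → refl ; a (suc n) → refl }
    ; 0-homo = λ { zero → refl ; (suc n) → refl }
    ; 1-homo = λ { zero → refl ; (suc n) → refl } }

  cst-≟ : ∀ a b → Maybe (cst a ≈ cst b)
  cst-≟ a b with a ℤP.≟ b
  ... | yes refl = just (λ n → refl)
  ... | no _     = nothing

  module SeriesSolver = RingSolver _ (fromCommutativeRing seriesRing) cst-morphism cst-≟

-- The indeterminate x, infinite sums Σ_b x^b f_b, the geometric series
-- 1/(1-x) and 1/(1-2x), and the way identities are verified: an equation
-- L ≈ R is proved by exhibiting L - R as a combination of differences that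
-- are already known to vanish (the combination itself is checked by the
-- ring solver).
module SeriesToolkit where

  open import Data.Nat using (zero; suc; _∸_)
  open import Data.Integer using (_+_; _*_)
  import Data.Integer.Properties as ℤP
  open import Relation.Binary.PropositionalEquality as Eq using (refl; cong; cong₂; trans)
  open import Function using (_∘_)
  open import Algebra.Bundles using (CommutativeRing)
  open PowerSeries
  open CommutativeRing seriesRing using () renaming (sym to ≈sym; trans to ≈trans; refl to ≈refl)
  open SeriesSolver using (solve; _:+_; _:*_; _:-_; con; _:=_)

  infixl 6 _⊖_
  _⊖_ : Series → Series → Series
  a ⊖ b = a ⊕ ⊝ b

  ⊕-cong : ∀ {a b c d} → a ≈ b → c ≈ d → a ⊕ c ≈ b ⊕ d
  ⊕-cong p q n = cong₂ _+_ (p n) (q n)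

  ⊕-congˡ : ∀ a {b c} → b ≈ c → a ⊕ b ≈ a ⊕ c
  ⊕-congˡ a = ⊕-cong {a} ≈refl

  ⊛-congˡ : ∀ c {a b} → a ≈ b → c ⊛ a ≈ c ⊛ b
  ⊛-congˡ c = ⊛-cong {c} ≈refl

  X : Series
  X zero          = + 0
  X (suc zero)    = + 1
  X (suc (suc n)) = + 0

  shift : Series → Series
  shift h zero    = + 0
  shift h (suc n) = h n

  X⊛-shift : ∀ h → X ⊛ h ≈ shift h
  X⊛-shift h zero    = refl
  X⊛-shift h (suc n) = trans (ℤP.+-identityˡ _) (trans (⊛-cong X-tail ≈refl n) (⊛-identityˡ h n))
    where
    X-tail : X ∘ suc ≈ 1ₛ
    X-tail zero    = refl
    X-tail (suc n) = refl

  -- Σx f = Σ_b x^b f_b; it is well defined since x^b f_b only affects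
  -- coefficients of degree ≥ b
  Σx : (ℕ → Series) → Series
  Σx f zero    = f 0 0
  Σx f (suc n) = f 0 (suc n) + Σx (f ∘ suc) n

  Σx-unfold : ∀ f → Σx f ≈ f 0 ⊕ X ⊛ Σx (f ∘ suc)
  Σx-unfold f zero    = Eq.sym (ℤP.+-identityʳ _)
  Σx-unfold f (suc n) = cong (_+_ (f 0 (suc n))) (Eq.sym (X⊛-shift (Σx (f ∘ suc)) (suc n)))

  Σx-cong : ∀ {f g} → (∀ b → f b ≈ g b) → Σx f ≈ Σx g
  Σx-cong p zero    = p 0 0
  Σx-cong p (suc n) = cong₂ _+_ (p 0 (suc n)) (Σx-cong (p ∘ suc) n)

  Σx-⊕ : ∀ f g → Σx (λ b → f b ⊕ g b) ≈ Σx f ⊕ Σx g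
  Σx-⊕ f g zero    = refl
  Σx-⊕ f g (suc n) =
    trans (cong (_+_ (f 0 (suc n) + g 0 (suc n))) (Σx-⊕ (f ∘ suc) (g ∘ suc) n))
          (+-interchange (f 0 (suc n)) (g 0 (suc n)) (Σx (f ∘ suc) n) (Σx (g ∘ suc) n))

  Σx-⊝ : ∀ f → Σx (λ b → ⊝ f b) ≈ ⊝ Σx f
  Σx-⊝ f zero    = refl
  Σx-⊝ f (suc n) =
    trans (cong (_+_ (- f 0 (suc n))) (Σx-⊝ (f ∘ suc) n))
          (Eq.sym (ℤP.neg-distrib-+ (f 0 (suc n)) (Σx (f ∘ suc) n)))

  Σx-scale : ∀ c f → Σx (λ b → c ⊛ f b) ≈ c ⊛ Σx f
  Σx-scale c f zero    = refl
  Σx-scale c f (suc n) = begin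
      (c ⊛ f 0) (suc n) + Σx (λ b → c ⊛ f (suc b)) n
    ≡⟨ cong (_+_ ((c ⊛ f 0) (suc n))) (Σx-scale c (f ∘ suc) n) ⟩
      (c ⊛ f 0) (suc n) + (c ⊛ Σx (f ∘ suc)) n
    ≡⟨ cong (_+_ ((c ⊛ f 0) (suc n))) (Eq.sym (X⊛-shift (c ⊛ Σx (f ∘ suc)) (suc n))) ⟩
      (c ⊛ f 0 ⊕ X ⊛ (c ⊛ Σx (f ∘ suc))) (suc n)
    ≡⟨ ≈sym (≈trans (⊛-distribˡ c (f 0) (X ⊛ Σx (f ∘ suc))) (⊕-congˡ (c ⊛ f 0) X-commutes)) (suc n) ⟩
      (c ⊛ (f 0 ⊕ X ⊛ Σx (f ∘ suc))) (suc n)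
    ≡⟨ ⊛-congˡ c (Σx-unfold f) (suc n) ⟨
      (c ⊛ Σx f) (suc n)
    ∎
    where
    open Eq.≡-Reasoning
    X-commutes : c ⊛ (X ⊛ Σx (f ∘ suc)) ≈ X ⊛ (c ⊛ Σx (f ∘ suc))
    X-commutes = solve 3 (λ c x s → c :* (x :* s) := x :* (c :* s)) ≈refl c X (Σx (f ∘ suc))

  poly : Poly → Series
  poly []       = 0ₛ
  poly (c ∷ cs) = cst c ⊕ X ⊛ poly cs

  coeff-poly : ∀ l → coeff l ≈ poly l
  coeff-poly []      zero    = refl
  coeff-poly []      (suc n) = refl
  coeff-poly (c ∷ l) zero    = Eq.sym (ℤP.+-identityʳ c)
  coeff-poly (c ∷ l) (suc n) =
    Eq.sym (trans (ℤP.+-identityˡ _) (trans (X⊛-shift (poly l) (suc n)) (Eq.sym (coeff-poly l n))))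

  ·ₛ-is-⊛ : ∀ p a → p ·ₛ a ≈ coeff p ⊛ a
  ·ₛ-is-⊛ p a n = convolution (coeff p) a n
    where
    sumTo-peel : ∀ n (G : ℕ → ℤ) → sumTo (suc n) G Eq.≡ G 0 + sumTo n (G ∘ suc)
    sumTo-peel zero    G = refl
    sumTo-peel (suc n) G = trans (cong (_+ G (suc (suc n))) (sumTo-peel n G))
                                 (ℤP.+-assoc (G 0) (sumTo n (G ∘ suc)) (G (suc (suc n))))
    convolution : ∀ f g n → sumTo n (λ i → f i * g (n ∸ i)) Eq.≡ (f ⊛ g) n
    convolution f g zero    = refl
    convolution f g (suc n) = trans (sumTo-peel n (λ i → f i * g (suc n ∸ i)))
                                    (cong (_+_ (f 0 * g (suc n))) (convolution (f ∘ suc) g n))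

  U : Series
  U n = + 1

  U-equation : U ≈ 1ₛ ⊕ X ⊛ U
  U-equation zero    = refl
  U-equation (suc n) = Eq.sym (trans (ℤP.+-identityˡ _) (X⊛-shift U (suc n)))

  Σx-const : ∀ c → Σx (λ _ → c) ≈ c ⊛ U
  Σx-const c = ≈trans (Σx-cong (λ _ → ≈sym (⊛-identityʳ c)))
                      (≈trans (Σx-scale c (λ _ → 1ₛ)) (⊛-congˡ c Σx-ones))
    where
    Σx-ones : Σx (λ _ → 1ₛ) ≈ U
    Σx-ones zero    = refl
    Σx-ones (suc n) = trans (ℤP.+-identityˡ _) (Σx-ones n)

  I₂ : Series
  I₂ zero    = + 1
  I₂ (suc n) = + 2 * I₂ n

  1-2x : Series
  1-2x = 1ₛ ⊖ cst (+ 2) ⊛ X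

  Vanishes : Series → Set
  Vanishes D = D ≈ 0ₛ

  difference-vanishes : ∀ {A B} → A ≈ B → Vanishes (A ⊖ B)
  difference-vanishes {A} {B} A≈B =
    ≈trans (⊕-cong A≈B ≈refl) (solve 1 (λ b → b :- b := con (+ 0)) ≈refl B)

  vanishes-⊛ : ∀ c {D} → Vanishes D → Vanishes (c ⊛ D)
  vanishes-⊛ c D≈0 = ≈trans (⊛-congˡ c D≈0) (solve 1 (λ c → c :* con (+ 0) := con (+ 0)) ≈refl c)

  vanishes-⊕ : ∀ {D E} → Vanishes D → Vanishes E → Vanishes (D ⊕ E)
  vanishes-⊕ D≈0 E≈0 = ≈trans (⊕-cong D≈0 E≈0) (solve 0 (con (+ 0) :+ con (+ 0) := con (+ 0)) ≈refl)

  ≈-from-vanishing : ∀ {L R} → Vanishes (L ⊖ R) → L ≈ R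
  ≈-from-vanishing {L} {R} d≈0 =
    ≈trans (solve 2 (λ l r → l := (l :- r) :+ r) ≈refl L R)
    (≈trans (⊕-cong d≈0 ≈refl) (solve 1 (λ r → con (+ 0) :+ r := r) ≈refl R))

  combination₁ : ∀ {L R A₁ B₁} c₁ → L ⊖ R ≈ c₁ ⊛ (A₁ ⊖ B₁) → A₁ ≈ B₁ → L ≈ R
  combination₁ c₁ e p₁ = ≈-from-vanishing (≈trans e (vanishes-⊛ c₁ (difference-vanishes p₁)))

  combination₂ : ∀ {L R A₁ B₁ A₂ B₂} c₁ c₂ →
    L ⊖ R ≈ c₁ ⊛ (A₁ ⊖ B₁) ⊕ c₂ ⊛ (A₂ ⊖ B₂) → A₁ ≈ B₁ → A₂ ≈ B₂ → L ≈ R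
  combination₂ c₁ c₂ e p₁ p₂ = ≈-from-vanishing (≈trans e
    (vanishes-⊕ (vanishes-⊛ c₁ (difference-vanishes p₁)) (vanishes-⊛ c₂ (difference-vanishes p₂))))

  combination₃ : ∀ {L R A₁ B₁ A₂ B₂ A₃ B₃} c₁ c₂ c₃ →
    L ⊖ R ≈ c₁ ⊛ (A₁ ⊖ B₁) ⊕ c₂ ⊛ (A₂ ⊖ B₂) ⊕ c₃ ⊛ (A₃ ⊖ B₃) →
    A₁ ≈ B₁ → A₂ ≈ B₂ → A₃ ≈ B₃ → L ≈ R
  combination₃ c₁ c₂ c₃ e p₁ p₂ p₃ = ≈-from-vanishing (≈trans e
    (vanishes-⊕ (vanishes-⊕ (vanishes-⊛ c₁ (difference-vanishes p₁)) (vanishes-⊛ c₂ (difference-vanishes p₂)))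
                (vanishes-⊛ c₃ (difference-vanishes p₃))))

  combination₄ : ∀ {L R A₁ B₁ A₂ B₂ A₃ B₃ A₄ B₄} c₁ c₂ c₃ c₄ →
    L ⊖ R ≈ c₁ ⊛ (A₁ ⊖ B₁) ⊕ c₂ ⊛ (A₂ ⊖ B₂) ⊕ c₃ ⊛ (A₃ ⊖ B₃) ⊕ c₄ ⊛ (A₄ ⊖ B₄) →
    A₁ ≈ B₁ → A₂ ≈ B₂ → A₃ ≈ B₃ → A₄ ≈ B₄ → L ≈ R
  combination₄ c₁ c₂ c₃ c₄ e p₁ p₂ p₃ p₄ = ≈-from-vanishing (≈trans e
    (vanishes-⊕ (vanishes-⊕ (vanishes-⊕ (vanishes-⊛ c₁ (difference-vanishes p₁))
                                        (vanishes-⊛ c₂ (difference-vanishes p₂)))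
                            (vanishes-⊛ c₃ (difference-vanishes p₃)))
                (vanishes-⊛ c₄ (difference-vanishes p₄))))

  I₂-inverse : 1-2x ⊛ I₂ ≈ 1ₛ
  I₂-inverse = combination₁ 1ₛ
    (solve 2 (λ i x → (con (+ 1) :- con (+ 2) :* x) :* i :- con (+ 1)
                     := con (+ 1) :* (i :- (con (+ 1) :+ con (+ 2) :* (x :* i))))
           ≈refl I₂ X)
    I₂-equation
    where
    I₂-equation : I₂ ≈ 1ₛ ⊕ cst (+ 2) ⊛ (X ⊛ I₂)
    I₂-equation zero    = refl
    I₂-equation (suc n) = Eq.sym (trans (ℤP.+-identityˡ _)
      (trans (⊛-cstˡ (+ 2) (X ⊛ I₂) (suc n)) (cong (_*_ (+ 2)) (X⊛-shift I₂ (suc n)))))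

  I₂-cancel : ∀ Y → 1-2x ⊛ (I₂ ⊛ Y) ≈ Y
  I₂-cancel Y = ≈trans (≈sym (⊛-assoc 1-2x I₂ Y)) (≈trans (⊛-cong I₂-inverse ≈refl) (⊛-identityˡ Y))

-- Each state s gets a series gf s, built from the
-- auxiliary families α, β, ω, ζ, such that gf s = 1 + x Σ_{c child of s} gf c.
-- Consequently the coefficient of xᵐ in gf s is the number of nodes at depth
-- m below s.
module GeneratingTree where

  open import Data.Nat using (zero; suc; _+_)
  open import Data.Nat.Properties using (+-suc)
  open import Data.List using (_++_)
  open import Relation.Binary.PropositionalEquality as Eq using (cong)
  open import Algebra.Bundles using (CommutativeRing)
  import Relation.Binary.Reasoning.Setoid as SetoidReasoning
  open PowerSeries
  open SeriesToolkit
  open CommutativeRing seriesRing using (setoid) renaming (sym to ≈sym; trans to ≈trans; refl to ≈refl)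
  open SetoidReasoning setoid
  open SeriesSolver using (solve; _:+_; _:*_; _:-_; :-_; con; _:=_)

  data State : Set where
    sA : ℕ → State
    sP : ℕ → ℕ → State
    sQ : ℕ → State

  qRun : ℕ → ℕ → List State
  qRun k zero    = []
  qRun k (suc r) = sQ k ∷ qRun (suc k) r

  pRun : ℕ → ℕ → List State
  pRun a zero    = []
  pRun a (suc j) = sP a (suc j) ∷ pRun (suc a) j

  children : State → List State
  children (sA j)   = sA (suc j) ∷ pRun 0 j
  children (sP a b) = sP 0 b ∷ (qRun 1 a ++ (sP a 0 ∷ pRun (suc a) b))
  children (sQ a)   = sQ 0 ∷ qRun 1 a

  U² : Series
  U² = U ⊛ U

  U^ : ℕ → Series
  U^ zero    = 1ₛ
  U^ (suc a) = U ⊛ U^ a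

  α : ℕ → Series
  α zero    = U²
  α (suc b) = I₂ ⊛ (α b ⊖ X ⊛ U²)

  β : ℕ → Series
  β zero    = I₂ ⊖ U²
  β (suc b) = I₂ ⊛ ((1ₛ ⊖ X) ⊛ β b ⊕ X ⊛ (α (suc b) ⊖ α b))

  -- ω_j = Σ_{i=1..j} U^(j-i) α_i  and  ζ_j = Σ_{i=1..j} β_i
  ω : ℕ → Series
  ω zero    = 0ₛ
  ω (suc j) = α (suc j) ⊕ U ⊛ ω j

  ζ : ℕ → Series
  ζ zero    = 0ₛ
  ζ (suc j) = β (suc j) ⊕ ζ j

  gf : State → Series
  gf (sA j)   = Σx (λ i → 1ₛ ⊕ X ⊛ (ω (i + j) ⊕ ζ (i + j)))
  gf (sP a b) = α b ⊛ U^ a ⊕ β b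
  gf (sQ a)   = U^ (suc a)

  Σgf : List State → Series
  Σgf []      = 0ₛ
  Σgf (s ∷ l) = gf s ⊕ Σgf l

  Σgf-++ : ∀ l m → Σgf (l ++ m) ≈ Σgf l ⊕ Σgf m
  Σgf-++ []      m = solve 1 (λ y → y := con (+ 0) :+ y) ≈refl (Σgf m)
  Σgf-++ (s ∷ l) m = ≈trans (⊕-congˡ (gf s) (Σgf-++ l m))
    (solve 3 (λ x a b → x :+ (a :+ b) := x :+ a :+ b) ≈refl (gf s) (Σgf l) (Σgf m))

  α-decomposition : ∀ b → α b ≈ U² ⊕ X ⊛ (U ⊛ ω b)
  α-decomposition zero    = solve 2 (λ u x → u :* u := u :* u :+ x :* (u :* con (+ 0))) ≈refl U X
  α-decomposition (suc b) = combination₃ U U (U² ⊖ α (suc b))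
    (solve 5 (λ u x a′ a w →
       a′ :- (u :* u :+ x :* (u :* (a′ :+ u :* w)))
       := u :* ((con (+ 1) :- con (+ 2) :* x) :* a′ :- (a :- x :* (u :* u)))
          :+ u :* (a :- (u :* u :+ x :* (u :* w)))
          :+ (u :* u :- a′) :* (u :- (con (+ 1) :+ x :* u)))
       ≈refl U X (α (suc b)) (α b) (ω b))
    (I₂-cancel (α b ⊖ X ⊛ U²)) (α-decomposition b) U-equation

  β-decomposition : ∀ b → β b ≈ (1ₛ ⊖ U ⊕ X ⊛ β 0) ⊕ X ⊛ (α b ⊕ β b) ⊕ X ⊛ ζ b
  β-decomposition zero    = combination₂ 1ₛ (⊝ U)
    (solve 3 (λ u x i →
       (i :- u :* u) :- ((con (+ 1) :- u :+ x :* (i :- u :* u)) :+ x :* (u :* u :+ (i :- u :* u)) :+ x :* con (+ 0))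
       := con (+ 1) :* ((con (+ 1) :- con (+ 2) :* x) :* i :- con (+ 1))
          :+ (:- u) :* (u :- (con (+ 1) :+ x :* u)))
       ≈refl U X I₂)
    I₂-inverse U-equation
  β-decomposition (suc b) = combination₂ 1ₛ 1ₛ
    (solve 7 (λ x k a′ a b′ b z →
       b′ :- (k :+ x :* (a′ :+ b′) :+ x :* (b′ :+ z))
       := con (+ 1) :* ((con (+ 1) :- con (+ 2) :* x) :* b′ :- ((con (+ 1) :- x) :* b :+ x :* (a′ :- a)))
          :+ con (+ 1) :* (b :- (k :+ x :* (a :+ b) :+ x :* z)))
       ≈refl X (1ₛ ⊖ U ⊕ X ⊛ β 0) (α (suc b)) (α b) (β (suc b)) (β b) (ζ b))
    (I₂-cancel ((1ₛ ⊖ X) ⊛ β b ⊕ X ⊛ (α (suc b) ⊖ α b))) (β-decomposition b)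

  -- x Σ_{i=k..k+r-1} U^(i+1) telescopes to U^k (U^r - 1)
  Σgf-qRun : ∀ k r → X ⊛ Σgf (qRun k r) ≈ U^ k ⊛ (U^ r ⊖ 1ₛ)
  Σgf-qRun k zero    = solve 2 (λ x p → x :* con (+ 0) := p :* (con (+ 1) :- con (+ 1))) ≈refl X (U^ k)
  Σgf-qRun k (suc r) = combination₂ (⊝ U^ k) 1ₛ
    (solve 5 (λ u x p q s →
       x :* (u :* p :+ s) :- p :* (u :* q :- con (+ 1))
       := (:- p) :* (u :- (con (+ 1) :+ x :* u))
          :+ con (+ 1) :* (x :* s :- u :* p :* (q :- con (+ 1))))
       ≈refl U X (U^ k) (U^ r) (Σgf (qRun (suc k) r)))
    U-equation (Σgf-qRun (suc k) r)

  Σgf-pRun : ∀ a j → Σgf (pRun a j) ≈ U^ a ⊛ ω j ⊕ ζ j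
  Σgf-pRun a zero    = solve 1 (λ p → con (+ 0) := p :* con (+ 0) :+ con (+ 0)) ≈refl (U^ a)
  Σgf-pRun a (suc j) = ≈trans (⊕-congˡ (gf (sP a (suc j))) (Σgf-pRun (suc a) j))
    (solve 6 (λ u p a′ b′ w z → a′ :* p :+ b′ :+ (u :* p :* w :+ z) := p :* (a′ :+ u :* w) :+ (b′ :+ z))
      ≈refl U (U^ a) (α (suc j)) (β (suc j)) (ω j) (ζ j))

  gf-equation : ∀ s → gf s ≈ 1ₛ ⊕ X ⊛ Σgf (children s)
  gf-equation (sQ a) = combination₂ 1ₛ (⊝ 1ₛ)
    (solve 4 (λ u x p h → u :* p :- (con (+ 1) :+ x :* (u :* con (+ 1) :+ h))
       := con (+ 1) :* (u :- (con (+ 1) :+ x :* u))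
          :+ (:- con (+ 1)) :* (x :* h :- u :* con (+ 1) :* (p :- con (+ 1))))
       ≈refl U X (U^ a) (Σgf (qRun 1 a)))
    U-equation (Σgf-qRun 1 a)
  gf-equation (sP a b) = begin
      α b ⊛ U^ a ⊕ β b
    ≈⟨ combination₄ (U ⊛ U^ a) (U^ a) 1ₛ (⊝ 1ₛ)
         (solve 9 (λ u x p a′ b′ w z h b₀ →
            a′ :* p :+ b′ :- (con (+ 1) :+ x :* ((a′ :* con (+ 1) :+ b′) :+ (h :+ ((u :* u :* p :+ b₀) :+ ((u :* p) :* w :+ z)))))
            := u :* p :* (u :- (con (+ 1) :+ x :* u))
               :+ p :* (a′ :- (u :* u :+ x :* (u :* w)))
               :+ con (+ 1) :* (b′ :- ((con (+ 1) :- u :+ x :* b₀) :+ x :* (a′ :+ b′) :+ x :* z))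
               :+ (:- con (+ 1)) :* (x :* h :- u :* con (+ 1) :* (p :- con (+ 1))))
            ≈refl U X (U^ a) (α b) (β b) (ω b) (ζ b) (Σgf (qRun 1 a)) (β 0))
         U-equation (α-decomposition b) (β-decomposition b) (Σgf-qRun 1 a) ⟩
      1ₛ ⊕ X ⊛ (gf (sP 0 b) ⊕ (Σgf (qRun 1 a) ⊕ (gf (sP a 0) ⊕ (U^ (suc a) ⊛ ω b ⊕ ζ b))))
    ≈⟨ ⊕-congˡ 1ₛ (⊛-congˡ X (⊕-congˡ (gf (sP 0 b)) (≈sym grandchildren))) ⟩
      1ₛ ⊕ X ⊛ Σgf (children (sP a b))
    ∎
    where
    grandchildren : Σgf (qRun 1 a ++ (sP a 0 ∷ pRun (suc a) b))
                    ≈ Σgf (qRun 1 a) ⊕ (gf (sP a 0) ⊕ (U^ (suc a) ⊛ ω b ⊕ ζ b))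
    grandchildren = ≈trans (Σgf-++ (qRun 1 a) (sP a 0 ∷ pRun (suc a) b))
                           (⊕-congˡ (Σgf (qRun 1 a)) (⊕-congˡ (gf (sP a 0)) (Σgf-pRun (suc a) b)))
  gf-equation (sA j) = begin
      Σx (λ i → 1ₛ ⊕ X ⊛ V (i + j))
    ≈⟨ Σx-unfold (λ i → 1ₛ ⊕ X ⊛ V (i + j)) ⟩
      (1ₛ ⊕ X ⊛ V j) ⊕ X ⊛ Σx (λ i → 1ₛ ⊕ X ⊛ V (suc (i + j)))
    ≈⟨ ⊕-congˡ (1ₛ ⊕ X ⊛ V j) (⊛-congˡ X (Σx-cong (λ i n → cong (λ k → (1ₛ ⊕ X ⊛ V k) n) (Eq.sym (+-suc i j))))) ⟩
      (1ₛ ⊕ X ⊛ V j) ⊕ X ⊛ gf (sA (suc j))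
    ≈⟨ solve 4 (λ x w z e → (con (+ 1) :+ x :* (w :+ z)) :+ x :* e := con (+ 1) :+ x :* (e :+ (con (+ 1) :* w :+ z)))
         ≈refl X (ω j) (ζ j) (gf (sA (suc j))) ⟩
      1ₛ ⊕ X ⊛ (gf (sA (suc j)) ⊕ (1ₛ ⊛ ω j ⊕ ζ j))
    ≈⟨ ⊕-congˡ 1ₛ (⊛-congˡ X (⊕-congˡ (gf (sA (suc j))) (≈sym (Σgf-pRun 0 j)))) ⟩
      1ₛ ⊕ X ⊛ Σgf (children (sA j))
    ∎
    where
    V : ℕ → Series
    V k = ω k ⊕ ζ k


module TreeLevels where

  open import Data.Nat using (zero; suc)
  open import Data.Integer using () renaming (_+_ to _+ℤ_)
  import Data.Integer.Properties as ℤP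
  open import Data.List using (_++_; concatMap; length)
  open import Relation.Binary.PropositionalEquality
  open PowerSeries
  open SeriesToolkit
  open GeneratingTree

  grow : ℕ → List State → List State
  grow zero    l = l
  grow (suc m) l = grow m (concatMap children l)

  grow-suc : ∀ m l → grow (suc m) l ≡ concatMap children (grow m l)
  grow-suc zero    l = refl
  grow-suc (suc m) l = grow-suc m (concatMap children l)

  -- by the functional equation, coefficient m+1 of gf s is coefficient m
  -- of the series of the children of s
  Σgf-children : ∀ m l → Σgf l (suc m) ≡ Σgf (concatMap children l) m
  Σgf-children m []      = sym (0ₛ-coeff m)
  Σgf-children m (s ∷ l) = begin
      gf s (suc m) +ℤ Σgf l (suc m)
    ≡⟨ cong₂ _+ℤ_ (gf-equation s (suc m)) (Σgf-children m l) ⟩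
      + 0 +ℤ (X ⊛ Σgf (children s)) (suc m) +ℤ Σgf (concatMap children l) m
    ≡⟨ cong (_+ℤ Σgf (concatMap children l) m) (trans (ℤP.+-identityˡ _) (X⊛-shift _ (suc m))) ⟩
      Σgf (children s) m +ℤ Σgf (concatMap children l) m
    ≡⟨ Σgf-++ (children s) (concatMap children l) m ⟨
      Σgf (children s ++ concatMap children l) m
    ∎
    where open ≡-Reasoning

  -- every node contributes 1 to coefficient 0
  Σgf-length : ∀ l → + length l ≡ Σgf l 0
  Σgf-length []      = refl
  Σgf-length (s ∷ l) = trans (ℤP.pos-+ 1 (length l))
    (cong₂ _+ℤ_ (sym (trans (gf-equation s 0) (ℤP.+-identityʳ (+ 1)))) (Σgf-length l))

  grow-counted : ∀ m l → + length (grow m l) ≡ Σgf l m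
  grow-counted zero    l = Σgf-length l
  grow-counted (suc m) l = trans (grow-counted m (concatMap children l)) (sym (Σgf-children m l))

  level : ℕ → List State
  level n = grow n (sA 0 ∷ [])

  level-counted : ∀ n → + length (level n) ≡ gf (sA 0) n
  level-counted n = trans (grow-counted n (sA 0 ∷ []))
    (trans (cong (gf (sA 0) n +ℤ_) (0ₛ-coeff n)) (ℤP.+-identityʳ _))

-- With Φ = Σx α, Ψ = Σx β,
-- Ω = Σx ω, Z = Σx ζ (and Φ′, Ψ′ the shifted sums), the recursions for
-- α, β, ω, ζ become linear equations over ℤ[x] whose solution gives
--   (1-x)³(1-2x)(1-3x)(1-3x+x²) · gf (sA 0) = 1 - 10x + 40x² - 81x³ + 88x⁴ - 50x⁵ + 11x⁶.
module ClosedForm where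

  open import Data.Nat using (suc; _+_)
  open import Data.Nat.Properties using (+-identityʳ)
  open import Relation.Binary.PropositionalEquality as Eq using (refl; cong)
  open import Function using (_∘_)
  open import Algebra.Bundles using (CommutativeRing)
  import Relation.Binary.Reasoning.Setoid as SetoidReasoning
  open PowerSeries
  open SeriesToolkit
  open GeneratingTree
  open CommutativeRing seriesRing using (setoid) renaming (sym to ≈sym; trans to ≈trans; refl to ≈refl)
  open SetoidReasoning setoid
  open SeriesSolver using (solve; _:+_; _:*_; _:-_; :-_; con; _:=_; Polynomial)

  Φ Φ′ Ψ Ψ′ Ω Z : Series
  Φ  = Σx α
  Φ′ = Σx (α ∘ suc)
  Ψ  = Σx β
  Ψ′ = Σx (β ∘ suc)
  Ω  = Σx ω
  Z  = Σx ζ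

  1-x 1-3x 1-3x+x² : Series
  1-x      = 1ₛ ⊖ X
  1-3x     = 1ₛ ⊖ cst (+ 3) ⊛ X
  1-3x+x²  = 1ₛ ⊖ cst (+ 3) ⊛ X ⊕ X ⊛ X

  module _ {k : ℕ} where
    P₁ P₂ P₃ Pq : Polynomial k → Polynomial k
    P₁ x = con (+ 1) :- x
    P₂ x = con (+ 1) :- con (+ 2) :* x
    P₃ x = con (+ 1) :- con (+ 3) :* x
    Pq x = con (+ 1) :- con (+ 3) :* x :+ x :* x
    -- U - (1 + xU), which vanishes
    Ueq : Polynomial k → Polynomial k → Polynomial k
    Ueq u x = u :- (con (+ 1) :+ x :* u)

  Φ-unfold : Φ ≈ U² ⊕ X ⊛ Φ′
  Φ-unfold = Σx-unfold α

  Ψ-unfold : Ψ ≈ β 0 ⊕ X ⊛ Ψ′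
  Ψ-unfold = Σx-unfold β

  Φ′-equation : 1-2x ⊛ Φ′ ≈ Φ ⊕ (⊝ (X ⊛ U²)) ⊛ U
  Φ′-equation = begin
      1-2x ⊛ Φ′
    ≈⟨ ≈sym (Σx-scale 1-2x (α ∘ suc)) ⟩
      Σx (λ b → 1-2x ⊛ α (suc b))
    ≈⟨ Σx-cong (λ b → I₂-cancel (α b ⊖ X ⊛ U²)) ⟩
      Σx (λ b → α b ⊖ X ⊛ U²)
    ≈⟨ Σx-⊕ α (λ _ → ⊝ (X ⊛ U²)) ⟩
      Φ ⊕ Σx (λ _ → ⊝ (X ⊛ U²))
    ≈⟨ ⊕-congˡ Φ (Σx-const (⊝ (X ⊛ U²))) ⟩
      Φ ⊕ (⊝ (X ⊛ U²)) ⊛ U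
    ∎

  Ψ′-equation : 1-2x ⊛ Ψ′ ≈ 1-x ⊛ Ψ ⊕ X ⊛ (Φ′ ⊕ ⊝ Φ)
  Ψ′-equation = begin
      1-2x ⊛ Ψ′
    ≈⟨ ≈sym (Σx-scale 1-2x (β ∘ suc)) ⟩
      Σx (λ b → 1-2x ⊛ β (suc b))
    ≈⟨ Σx-cong (λ b → I₂-cancel (1-x ⊛ β b ⊕ X ⊛ (α (suc b) ⊖ α b))) ⟩
      Σx (λ b → 1-x ⊛ β b ⊕ X ⊛ (α (suc b) ⊖ α b))
    ≈⟨ Σx-⊕ (λ b → 1-x ⊛ β b) (λ b → X ⊛ (α (suc b) ⊖ α b)) ⟩
      Σx (λ b → 1-x ⊛ β b) ⊕ Σx (λ b → X ⊛ (α (suc b) ⊖ α b))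
    ≈⟨ ⊕-cong (Σx-scale 1-x β) (Σx-scale X (λ b → α (suc b) ⊖ α b)) ⟩
      1-x ⊛ Ψ ⊕ X ⊛ Σx (λ b → α (suc b) ⊖ α b)
    ≈⟨ ⊕-congˡ (1-x ⊛ Ψ) (⊛-congˡ X (≈trans (Σx-⊕ (α ∘ suc) (λ b → ⊝ α b)) (⊕-congˡ Φ′ (Σx-⊝ α)))) ⟩
      1-x ⊛ Ψ ⊕ X ⊛ (Φ′ ⊕ ⊝ Φ)
    ∎

  Ω-equation : Ω ≈ 0ₛ ⊕ X ⊛ (Φ′ ⊕ U ⊛ Ω)
  Ω-equation = ≈trans (Σx-unfold ω)
    (⊕-congˡ 0ₛ (⊛-congˡ X (≈trans (Σx-⊕ (α ∘ suc) (λ j → U ⊛ ω j)) (⊕-congˡ Φ′ (Σx-scale U ω)))))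

  Z-equation : Z ≈ 0ₛ ⊕ X ⊛ (Ψ′ ⊕ Z)
  Z-equation = ≈trans (Σx-unfold ζ) (⊕-congˡ 0ₛ (⊛-congˡ X (Σx-⊕ (β ∘ suc) ζ)))

  Φ′-closed : 1-x ⊛ 1-x ⊛ 1-x ⊛ 1-3x ⊛ Φ′ ≈ 1-2x
  Φ′-closed = combination₃ (1-x ⊛ 1-x ⊛ 1-x) (1-x ⊛ 1-x ⊛ 1-x)
    (1-x ⊛ (cst (+ 2) ⊕ H) ⊖ X ⊛ (cst (+ 3) ⊕ cst (+ 3) ⊛ H ⊕ H ⊛ H))
    (solve 4 (λ x u f f′ →
       P₁ x :* P₁ x :* P₁ x :* P₃ x :* f′ :- P₂ x
       := P₁ x :* P₁ x :* P₁ x :* (P₂ x :* f′ :- (f :+ (:- (x :* (u :* u))) :* u))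
          :+ P₁ x :* P₁ x :* P₁ x :* (f :- (u :* u :+ x :* f′))
          :+ (P₁ x :* (con (+ 2) :+ Ueq u x) :- x :* (con (+ 3) :+ con (+ 3) :* Ueq u x :+ Ueq u x :* Ueq u x))
             :* Ueq u x)
       ≈refl X U Φ Φ′)
    Φ′-equation Φ-unfold U-equation
    where
    H : Series
    H = U ⊖ (1ₛ ⊕ X ⊛ U)

  Ω-closed : 1-x ⊛ 1-x ⊛ 1-x ⊛ 1-3x ⊛ 1-2x ⊛ Ω ≈ X ⊛ 1-x ⊛ 1-2x
  Ω-closed = combination₃ (1-x ⊛ 1-x ⊛ 1-x ⊛ 1-x ⊛ 1-3x) (X ⊛ 1-x) (1-x ⊛ 1-x ⊛ 1-x ⊛ 1-3x ⊛ X ⊛ Ω)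
    (solve 4 (λ x u f′ w →
       P₁ x :* P₁ x :* P₁ x :* P₃ x :* P₂ x :* w :- x :* P₁ x :* P₂ x
       := P₁ x :* P₁ x :* P₁ x :* P₁ x :* P₃ x :* (w :- (con (+ 0) :+ x :* (f′ :+ u :* w)))
          :+ x :* P₁ x :* (P₁ x :* P₁ x :* P₁ x :* P₃ x :* f′ :- P₂ x)
          :+ P₁ x :* P₁ x :* P₁ x :* P₃ x :* x :* w :* Ueq u x)
       ≈refl X U Φ′ Ω)
    Ω-equation Φ′-closed U-equation

  Ψ′-relation : 1-3x+x² ⊛ Ψ′ ≈ 1-x ⊛ β 0 ⊕ X ⊛ 1-x ⊛ Φ′ ⊖ X ⊛ U²
  Ψ′-relation = combination₃ 1ₛ 1-x (⊝ X)
    (solve 7 (λ x u f f′ p p′ b₀ →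
       Pq x :* p′ :- (P₁ x :* b₀ :+ x :* P₁ x :* f′ :- x :* (u :* u))
       := con (+ 1) :* (P₂ x :* p′ :- (P₁ x :* p :+ x :* (f′ :+ :- f)))
          :+ P₁ x :* (p :- (b₀ :+ x :* p′))
          :+ (:- x) :* (f :- (u :* u :+ x :* f′)))
       ≈refl X U Φ Φ′ Ψ Ψ′ (β 0))
    Ψ′-equation Ψ-unfold Φ-unfold

  NΨ′ : Series
  NΨ′ = 1-x ⊛ 1-x ⊛ 1-x ⊛ 1-3x ⊖ 1-x ⊛ 1-2x ⊛ 1-3x ⊕ X ⊛ 1-2x ⊛ 1-2x ⊖ X ⊛ 1-2x ⊛ 1-3x

  Ψ′-closed : 1-x ⊛ 1-x ⊛ 1-2x ⊛ 1-3x ⊛ 1-3x+x² ⊛ Ψ′ ≈ NΨ′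
  Ψ′-closed = combination₄ (1-x ⊛ 1-x ⊛ 1-2x ⊛ 1-3x) (1-x ⊛ 1-x ⊛ 1-x ⊛ 1-3x) (X ⊛ 1-2x)
    (⊝ (1-x ⊛ 1-2x ⊛ 1-3x ⊛ (cst (+ 2) ⊕ H)) ⊖ X ⊛ 1-2x ⊛ 1-3x ⊛ (cst (+ 2) ⊕ H))
    (solve 5 (λ x u i f′ p′ →
       P₁ x :* P₁ x :* P₂ x :* P₃ x :* Pq x :* p′
         :- (P₁ x :* P₁ x :* P₁ x :* P₃ x :- P₁ x :* P₂ x :* P₃ x :+ x :* P₂ x :* P₂ x :- x :* P₂ x :* P₃ x)
       := P₁ x :* P₁ x :* P₂ x :* P₃ x :* (Pq x :* p′ :- (P₁ x :* (i :- u :* u) :+ x :* P₁ x :* f′ :- x :* (u :* u)))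
          :+ P₁ x :* P₁ x :* P₁ x :* P₃ x :* (P₂ x :* i :- con (+ 1))
          :+ x :* P₂ x :* (P₁ x :* P₁ x :* P₁ x :* P₃ x :* f′ :- P₂ x)
          :+ (:- (P₁ x :* P₂ x :* P₃ x :* (con (+ 2) :+ Ueq u x)) :- x :* P₂ x :* P₃ x :* (con (+ 2) :+ Ueq u x))
             :* Ueq u x)
       ≈refl X U I₂ Φ′ Ψ′)
    Ψ′-relation I₂-inverse Φ′-closed U-equation
    where
    H : Series
    H = U ⊖ (1ₛ ⊕ X ⊛ U)

  root-decomposition : gf (sA 0) ≈ U ⊕ X ⊛ (Ω ⊕ Z)
  root-decomposition =
    ≈trans (Σx-cong (λ i n → cong (λ k → (1ₛ ⊕ X ⊛ (ω k ⊕ ζ k)) n) (+-identityʳ i)))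
    (≈trans (Σx-⊕ (λ _ → 1ₛ) (λ i → X ⊛ (ω i ⊕ ζ i)))
    (⊕-cong (≈trans (Σx-const 1ₛ) (⊛-identityˡ U)) (≈trans (Σx-scale X (λ i → ω i ⊕ ζ i)) (⊛-congˡ X (Σx-⊕ ω ζ)))))

  denominator : Series
  denominator = 1-x ⊛ 1-x ⊛ 1-x ⊛ 1-2x ⊛ 1-3x ⊛ 1-3x+x²

  denominatorPoly : Poly
  denominatorPoly = ((((((+ 1 ∷ - (+ 1) ∷ []) ·ₚ (+ 1 ∷ - (+ 1) ∷ [])) ·ₚ (+ 1 ∷ - (+ 1) ∷ []))
                     ·ₚ (+ 1 ∷ - (+ 2) ∷ [])) ·ₚ (+ 1 ∷ - (+ 3) ∷ [])) ·ₚ (+ 1 ∷ - (+ 3) ∷ + 1 ∷ []))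

  denominatorPoly-series : poly denominatorPoly ≈ denominator
  denominatorPoly-series =
    solve 1 (λ x → con (+ 1) :+ x :* (con (- (+ 11)) :+ x :* (con (+ 49) :+ x :* (con (- (+ 114))
                   :+ x :* (con (+ 149) :+ x :* (con (- (+ 109)) :+ x :* (con (+ 41) :+ x :* (con (- (+ 6))
                   :+ x :* con (+ 0))))))))
                 := P₁ x :* P₁ x :* P₁ x :* P₂ x :* P₃ x :* Pq x) ≈refl X

  numerator : Poly
  numerator = + 1 ∷ - (+ 10) ∷ + 40 ∷ - (+ 81) ∷ + 88 ∷ - (+ 50) ∷ + 11 ∷ []

  root-closed-form : denominator ⊛ gf (sA 0) ≈ poly numerator
  root-closed-form = ≈trans (⊛-congˡ denominator root-decomposition)
    (combination₄ (1-x ⊛ 1-x ⊛ 1-2x ⊛ 1-3x ⊛ 1-3x+x²) (X ⊛ 1-3x+x²) (X ⊛ X) (X ⊛ 1-x ⊛ 1-x ⊛ 1-2x ⊛ 1-3x ⊛ 1-3x+x²)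
      (solve 5 (λ x u w z p′ →
         P₁ x :* P₁ x :* P₁ x :* P₂ x :* P₃ x :* Pq x :* (u :+ x :* (w :+ z))
           :- (con (+ 1) :+ x :* (con (- (+ 10)) :+ x :* (con (+ 40) :+ x :* (con (- (+ 81))
               :+ x :* (con (+ 88) :+ x :* (con (- (+ 50)) :+ x :* (con (+ 11) :+ x :* con (+ 0))))))))
         := P₁ x :* P₁ x :* P₂ x :* P₃ x :* Pq x :* Ueq u x
            :+ x :* Pq x :* (P₁ x :* P₁ x :* P₁ x :* P₃ x :* P₂ x :* w :- x :* P₁ x :* P₂ x)
            :+ x :* x :* (P₁ x :* P₁ x :* P₂ x :* P₃ x :* Pq x :* p′
                 :- (P₁ x :* P₁ x :* P₁ x :* P₃ x :- P₁ x :* P₂ x :* P₃ x :+ x :* P₂ x :* P₂ x :- x :* P₂ x :* P₃ x))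
            :+ x :* P₁ x :* P₁ x :* P₂ x :* P₃ x :* Pq x :* (z :- (con (+ 0) :+ x :* (p′ :+ z))))
         ≈refl X U Ω Z Ψ′)
      U-equation Ω-closed Ψ′-closed Z-equation)

-- The
-- key fact is how occurrences change when one entry m is inserted: the new
-- occurrences are exactly those using m (occurs-insert), and for k ≤ 4 these
-- split according to the position of m inside the occurrence.
module Occurrences where

  open import Data.Nat using (zero; suc; _<_)
  open import Data.Bool using (Bool; false; _∨_)
  open import Data.Bool.Properties using (∨-identityʳ; ∨-idempotentCommutativeMonoid)
  open import Data.Bool.ListAction using (any)
  open import Data.List using (_++_; map)
  open import Data.List.Relation.Unary.All using (All; _∷_)
  open import Relation.Binary.PropositionalEquality
  import Algebra.Solver.IdempotentCommutativeMonoid as ICM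

  module ∨-Solver = ICM ∨-idempotentCommutativeMonoid
  open ∨-Solver using (solve; _⊕_; _⊜_)

  Pred : ℕ → Set
  Pred zero    = Bool
  Pred (suc k) = ℕ → Pred k

  applyTo : ∀ k → Pred k → List ℕ → Bool
  applyTo zero    b []       = b
  applyTo zero    b (_ ∷ _)  = false
  applyTo (suc k) f []       = false
  applyTo (suc k) f (x ∷ xs) = applyTo k (f x) xs

  occurs : ∀ k → Pred k → List ℕ → Bool
  occurs zero    b xs       = b
  occurs (suc k) f []       = false
  occurs (suc k) f (x ∷ xs) = occurs k (f x) xs ∨ occurs (suc k) f xs

  any-++ : ∀ (p : List ℕ → Bool) xs ys → any p (xs ++ ys) ≡ any p xs ∨ any p ys
  any-++ p []       ys = refl
  any-++ p (x ∷ xs) ys = trans (cong (p x ∨_) (any-++ p xs ys))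
    (solve 3 (λ a b c → a ⊕ (b ⊕ c) ⊜ (a ⊕ b) ⊕ c) refl (p x) (any p xs) (any p ys))

  any-map : ∀ (p : List ℕ → Bool) (g : List ℕ → List ℕ) xs → any p (map g xs) ≡ any (λ s → p (g s)) xs
  any-map p g []       = refl
  any-map p g (x ∷ xs) = cong (p (g x) ∨_) (any-map p g xs)

  any-subseqs : ∀ k f xs → any (applyTo k f) (subseqs k xs) ≡ occurs k f xs
  any-subseqs zero    f xs       = ∨-identityʳ (applyTo zero f [])
  any-subseqs (suc k) f []       = refl
  any-subseqs (suc k) f (x ∷ xs) =
    trans (any-++ (applyTo (suc k) f) (map (x ∷_) (subseqs k xs)) (subseqs (suc k) xs))
          (cong₂ _∨_ (trans (any-map (applyTo (suc k) f) (x ∷_) (subseqs k xs)) (any-subseqs k (f x) xs))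
                     (any-subseqs (suc k) f xs))

  never : ∀ k → Pred k
  never zero    = false
  never (suc k) = λ _ → never k

  occurs-never : ∀ k xs → occurs k (never k) xs ≡ false
  occurs-never zero    xs       = refl
  occurs-never (suc k) []       = refl
  occurs-never (suc k) (x ∷ xs) = cong₂ _∨_ (occurs-never k xs) (occurs-never (suc k) xs)

  module Insertion (m : ℕ) where

    -- occurrences in X ++ m ∷ Y that use the entry m
    occursUsing : ∀ k → Pred k → List ℕ → List ℕ → Bool
    occursUsing zero    f X       Y = false
    occursUsing (suc k) f []      Y = occurs k (f m) Y
    occursUsing (suc k) f (x ∷ X) Y = occursUsing k (f x) X Y ∨ occursUsing (suc k) f X Y

    occurs-insert : ∀ k f X Y → occurs k f (X ++ m ∷ Y) ≡ occurs k f (X ++ Y) ∨ occursUsing k f X Y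
    occurs-insert zero    f X       Y = sym (∨-identityʳ f)
    occurs-insert (suc k) f []      Y = solve 2 (λ a b → a ⊕ b ⊜ b ⊕ a) refl (occurs k (f m) Y) (occurs (suc k) f Y)
    occurs-insert (suc k) f (x ∷ X) Y =
      trans (cong₂ _∨_ (occurs-insert k (f x) X Y) (occurs-insert (suc k) f X Y))
            (solve 4 (λ a b c d → (a ⊕ b) ⊕ (c ⊕ d) ⊜ (a ⊕ c) ⊕ (b ⊕ d)) refl
                   (occurs k (f x) (X ++ Y)) (occursUsing k (f x) X Y)
                   (occurs (suc k) f (X ++ Y)) (occursUsing (suc k) f X Y))

    -- occurrences through m, split by the position of m in the occurrence
    occursUsing₁ : ∀ f X Y → occursUsing 1 f X Y ≡ f m
    occursUsing₁ f []      Y = refl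
    occursUsing₁ f (x ∷ X) Y = occursUsing₁ f X Y

    occursUsing₂ : ∀ f X Y → occursUsing 2 f X Y ≡ occurs 1 (f m) Y ∨ occurs 1 (λ a → f a m) X
    occursUsing₂ f []      Y = sym (∨-identityʳ _)
    occursUsing₂ f (x ∷ X) Y = trans (cong₂ _∨_ (occursUsing₁ (f x) X Y) (occursUsing₂ f X Y))
      (solve 3 (λ a b c → a ⊕ (b ⊕ c) ⊜ b ⊕ (a ⊕ c)) refl
             (f x m) (occurs 1 (f m) Y) (occurs 1 (λ a → f a m) X))

    occursUsing₃ : ∀ f X Y → occursUsing 3 f X Y
      ≡ occurs 2 (f m) Y ∨ (occurs 1 (λ a → occurs 1 (f a m) Y) X ∨ occurs 2 (λ a b → f a b m) X)
    occursUsing₃ f []      Y = sym (∨-identityʳ _)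
    occursUsing₃ f (x ∷ X) Y = trans (cong₂ _∨_ (occursUsing₂ (f x) X Y) (occursUsing₃ f X Y))
      (solve 5 (λ p q A B C → (p ⊕ q) ⊕ (A ⊕ (B ⊕ C)) ⊜ A ⊕ ((p ⊕ B) ⊕ (q ⊕ C))) refl
             (occurs 1 (f x m) Y) (occurs 1 (λ a → f x a m) X) (occurs 2 (f m) Y)
             (occurs 1 (λ a → occurs 1 (f a m) Y) X) (occurs 2 (λ a b → f a b m) X))

    occursUsing₄ : ∀ f X Y → occursUsing 4 f X Y
      ≡ occurs 3 (f m) Y ∨ (occurs 1 (λ a → occurs 2 (f a m) Y) X
          ∨ (occurs 2 (λ a b → occurs 1 (f a b m) Y) X ∨ occurs 3 (λ a b c → f a b c m) X))
    occursUsing₄ f []      Y = sym (∨-identityʳ _)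
    occursUsing₄ f (x ∷ X) Y = trans (cong₂ _∨_ (occursUsing₃ (f x) X Y) (occursUsing₄ f X Y))
      (solve 7 (λ p q r A B C D → (p ⊕ (q ⊕ r)) ⊕ (A ⊕ (B ⊕ (C ⊕ D))) ⊜ A ⊕ ((p ⊕ B) ⊕ ((q ⊕ C) ⊕ (r ⊕ D)))) refl
             (occurs 2 (f x m) Y) (occurs 1 (λ a → occurs 1 (f x a m) Y) X) (occurs 2 (λ a b → f x a b m) X)
             (occurs 3 (f m) Y) (occurs 1 (λ a → occurs 2 (f a m) Y) X)
             (occurs 2 (λ a b → occurs 1 (f a b m) Y) X) (occurs 3 (λ a b c → f a b c m) X))

    AgreeBelow : ∀ k → Pred k → Pred k → Set
    AgreeBelow zero    b c = b ≡ c
    AgreeBelow (suc k) f g = ∀ x → x < m → AgreeBelow k (f x) (g x)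

    occurs-congBelow : ∀ k f g xs → All (_< m) xs → AgreeBelow k f g → occurs k f xs ≡ occurs k g xs
    occurs-congBelow zero    f g xs       _          e = e
    occurs-congBelow (suc k) f g []       _          e = refl
    occurs-congBelow (suc k) f g (x ∷ xs) (px ∷ pxs) e =
      cong₂ _∨_ (occurs-congBelow k (f x) (g x) xs pxs (e x px)) (occurs-congBelow (suc k) f g xs pxs e)

    occurs-false : ∀ k f xs → All (_< m) xs → AgreeBelow k f (never k) → occurs k f xs ≡ false
    occurs-false k f xs a e = trans (occurs-congBelow k f (never k) xs a e) (occurs-never k xs)

module PatternOrder where

  open import Data.Nat using (_<_; _≤_; _<ᵇ_)
  open import Data.Nat.Properties using (<ᵇ⇒<; <⇒<ᵇ; <⇒≱; <-trans; <⇒≤)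
  open import Data.Bool using (Bool; true; false; _∧_; T)
  open import Data.Bool.Properties using (T-≡)
  open import Data.Empty using (⊥-elim)
  open import Data.Product using (_×_; _,_)
  open import Function using (Equivalence)
  open import Relation.Binary.PropositionalEquality
  open import Defs using (orderIso; _==ᵇ_)

  <⇒<ᵇ≡true : ∀ {a b} → a < b → (a <ᵇ b) ≡ true
  <⇒<ᵇ≡true p = Equivalence.to T-≡ (<⇒<ᵇ p)

  ≤⇒<ᵇ≡false : ∀ {a b} → b ≤ a → (a <ᵇ b) ≡ false
  ≤⇒<ᵇ≡false {a} {b} q with a <ᵇ b in eq
  ... | false = refl
  ... | true = ⊥-elim (<⇒≱ (<ᵇ⇒< a b (subst T (sym eq) _)) q)

  <ᵇ≡true⇒< : ∀ {a b} → (a <ᵇ b) ≡ true → a < b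
  <ᵇ≡true⇒< {a} {b} e = <ᵇ⇒< a b (subst T (sym e) _)

  ==ᵇ-true : ∀ {x} → (x ==ᵇ true) ≡ true → x ≡ true
  ==ᵇ-true {true} e = refl

  bool-ext : ∀ {x y : Bool} → (x ≡ true → y ≡ true) → (y ≡ true → x ≡ true) → x ≡ y
  bool-ext {true} {true} f g = refl
  bool-ext {true} {false} f g = sym (f refl)
  bool-ext {false} {true} f g = g refl
  bool-ext {false} {false} f g = refl

  iso4 : List ℕ → ℕ → ℕ → ℕ → ℕ → Bool
  iso4 τ a b c d = orderIso (a ∷ b ∷ c ∷ d ∷ []) τ

  p1324 p1342 p3412 : List ℕ
  p1324 = 1 ∷ 3 ∷ 2 ∷ 4 ∷ []
  p1342 = 1 ∷ 3 ∷ 4 ∷ 2 ∷ []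
  p3412 = 3 ∷ 4 ∷ 1 ∷ 2 ∷ []

  -- copies of the two local functions of orderIso; on four-entry lists they
  -- unfold to the same Boolean expressions, which lets us take them apart
  heads : ℕ → ℕ → List ℕ → List ℕ → Bool
  heads a b []       []       = true
  heads a b (x ∷ xs) (y ∷ ys) = ((a <ᵇ x) ==ᵇ (b <ᵇ y)) ∧ ((x <ᵇ a) ==ᵇ (y <ᵇ b)) ∧ heads a b xs ys
  heads a b _        _        = false

  pairs : List ℕ → List ℕ → Bool
  pairs []       []       = true
  pairs (x ∷ xs) (y ∷ ys) = heads x y xs ys ∧ pairs xs ys
  pairs _        _        = false

  heads-< : ∀ a b x y xs ys → heads a b (x ∷ xs) (y ∷ ys) ≡ true → ((a <ᵇ x) ==ᵇ (b <ᵇ y)) ≡ true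
  heads-< a b x y xs ys e with (a <ᵇ x) ==ᵇ (b <ᵇ y)
  ... | true = refl
  heads-> : ∀ a b x y xs ys → heads a b (x ∷ xs) (y ∷ ys) ≡ true → ((x <ᵇ a) ==ᵇ (y <ᵇ b)) ≡ true
  heads-> a b x y xs ys e with (a <ᵇ x) ==ᵇ (b <ᵇ y) | (x <ᵇ a) ==ᵇ (y <ᵇ b)
  ... | true | true = refl
  heads-rest : ∀ a b x y xs ys → heads a b (x ∷ xs) (y ∷ ys) ≡ true → heads a b xs ys ≡ true
  heads-rest a b x y xs ys e with (a <ᵇ x) ==ᵇ (b <ᵇ y) | (x <ᵇ a) ==ᵇ (y <ᵇ b)
  ... | true | true = e
  pairs-heads : ∀ x y xs ys → pairs (x ∷ xs) (y ∷ ys) ≡ true → heads x y xs ys ≡ true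
  pairs-heads x y xs ys e with heads x y xs ys
  ... | true = refl
  pairs-rest : ∀ x y xs ys → pairs (x ∷ xs) (y ∷ ys) ≡ true → pairs xs ys ≡ true
  pairs-rest x y xs ys e with heads x y xs ys
  ... | true = e

  1324-order : ∀ a b c d → iso4 p1324 a b c d ≡ true → (a < c) × (c < b) × (b < d)
  1324-order a b c d e =
    <ᵇ≡true⇒< (==ᵇ-true (heads-< a 1 c 2 (d ∷ []) (4 ∷ []) (heads-rest a 1 b 3 (c ∷ d ∷ []) (2 ∷ 4 ∷ []) heads-a))) ,
    <ᵇ≡true⇒< (==ᵇ-true (heads-> b 3 c 2 (d ∷ []) (4 ∷ []) heads-b)) ,
    <ᵇ≡true⇒< (==ᵇ-true (heads-< b 3 d 4 [] [] (heads-rest b 3 c 2 (d ∷ []) (4 ∷ []) heads-b)))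
    where
    e′ : pairs (a ∷ b ∷ c ∷ d ∷ []) p1324 ≡ true
    e′ = e
    heads-a : heads a 1 (b ∷ c ∷ d ∷ []) (3 ∷ 2 ∷ 4 ∷ []) ≡ true
    heads-a = pairs-heads a 1 (b ∷ c ∷ d ∷ []) (3 ∷ 2 ∷ 4 ∷ []) e′
    heads-b : heads b 3 (c ∷ d ∷ []) (2 ∷ 4 ∷ []) ≡ true
    heads-b = pairs-heads b 3 (c ∷ d ∷ []) (2 ∷ 4 ∷ []) (pairs-rest a 1 (b ∷ c ∷ d ∷ []) (3 ∷ 2 ∷ 4 ∷ []) e′)
  order-1324 : ∀ {a b c d} → a < c → c < b → b < d → iso4 p1324 a b c d ≡ true
  order-1324 {a} {b} {c} {d} ac cb bd
    rewrite <⇒<ᵇ≡true (<-trans ac cb) | ≤⇒<ᵇ≡false (<⇒≤ (<-trans ac cb)) | <⇒<ᵇ≡true ac | ≤⇒<ᵇ≡false (<⇒≤ ac)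
          | <⇒<ᵇ≡true (<-trans ac (<-trans cb bd)) | ≤⇒<ᵇ≡false (<⇒≤ (<-trans ac (<-trans cb bd)))
          | ≤⇒<ᵇ≡false (<⇒≤ cb) | <⇒<ᵇ≡true cb | <⇒<ᵇ≡true bd | ≤⇒<ᵇ≡false (<⇒≤ bd)
          | <⇒<ᵇ≡true (<-trans cb bd) | ≤⇒<ᵇ≡false (<⇒≤ (<-trans cb bd)) = refl

  1342-order : ∀ a b c d → iso4 p1342 a b c d ≡ true → (a < d) × (d < b) × (b < c)
  1342-order a b c d e =
    <ᵇ≡true⇒< (==ᵇ-true (heads-< a 1 d 2 [] [] (heads-rest a 1 c 4 (d ∷ []) (2 ∷ []) (heads-rest a 1 b 3 (c ∷ d ∷ []) (4 ∷ 2 ∷ []) heads-a)))) ,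
    <ᵇ≡true⇒< (==ᵇ-true (heads-> b 3 d 2 [] [] (heads-rest b 3 c 4 (d ∷ []) (2 ∷ []) heads-b))) ,
    <ᵇ≡true⇒< (==ᵇ-true (heads-< b 3 c 4 (d ∷ []) (2 ∷ []) heads-b))
    where
    e′ : pairs (a ∷ b ∷ c ∷ d ∷ []) p1342 ≡ true
    e′ = e
    heads-a : heads a 1 (b ∷ c ∷ d ∷ []) (3 ∷ 4 ∷ 2 ∷ []) ≡ true
    heads-a = pairs-heads a 1 (b ∷ c ∷ d ∷ []) (3 ∷ 4 ∷ 2 ∷ []) e′
    heads-b : heads b 3 (c ∷ d ∷ []) (4 ∷ 2 ∷ []) ≡ true
    heads-b = pairs-heads b 3 (c ∷ d ∷ []) (4 ∷ 2 ∷ []) (pairs-rest a 1 (b ∷ c ∷ d ∷ []) (3 ∷ 4 ∷ 2 ∷ []) e′)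

  order-1342 : ∀ {a b c d} → a < d → d < b → b < c → iso4 p1342 a b c d ≡ true
  order-1342 {a} {b} {c} {d} ad db bc
    rewrite <⇒<ᵇ≡true (<-trans ad db) | ≤⇒<ᵇ≡false (<⇒≤ (<-trans ad db))
          | <⇒<ᵇ≡true (<-trans ad (<-trans db bc)) | ≤⇒<ᵇ≡false (<⇒≤ (<-trans ad (<-trans db bc)))
          | <⇒<ᵇ≡true ad | ≤⇒<ᵇ≡false (<⇒≤ ad)
          | <⇒<ᵇ≡true bc | ≤⇒<ᵇ≡false (<⇒≤ bc)
          | <⇒<ᵇ≡true db | ≤⇒<ᵇ≡false (<⇒≤ db)
          | <⇒<ᵇ≡true (<-trans db bc) | ≤⇒<ᵇ≡false (<⇒≤ (<-trans db bc)) = refl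

  3412-order : ∀ a b c d → iso4 p3412 a b c d ≡ true → (c < d) × (d < a) × (a < b)
  3412-order a b c d e =
    <ᵇ≡true⇒< (==ᵇ-true (heads-< c 1 d 2 [] [] heads-c)) ,
    <ᵇ≡true⇒< (==ᵇ-true (heads-> a 3 d 2 [] [] (heads-rest a 3 c 1 (d ∷ []) (2 ∷ []) (heads-rest a 3 b 4 (c ∷ d ∷ []) (1 ∷ 2 ∷ []) heads-a)))) ,
    <ᵇ≡true⇒< (==ᵇ-true (heads-< a 3 b 4 (c ∷ d ∷ []) (1 ∷ 2 ∷ []) heads-a))
    where
    e′ : pairs (a ∷ b ∷ c ∷ d ∷ []) p3412 ≡ true
    e′ = e
    heads-a : heads a 3 (b ∷ c ∷ d ∷ []) (4 ∷ 1 ∷ 2 ∷ []) ≡ true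
    heads-a = pairs-heads a 3 (b ∷ c ∷ d ∷ []) (4 ∷ 1 ∷ 2 ∷ []) e′
    pairs-bcd : pairs (b ∷ c ∷ d ∷ []) (4 ∷ 1 ∷ 2 ∷ []) ≡ true
    pairs-bcd = pairs-rest a 3 (b ∷ c ∷ d ∷ []) (4 ∷ 1 ∷ 2 ∷ []) e′
    heads-c : heads c 1 (d ∷ []) (2 ∷ []) ≡ true
    heads-c = pairs-heads c 1 (d ∷ []) (2 ∷ []) (pairs-rest b 4 (c ∷ d ∷ []) (1 ∷ 2 ∷ []) pairs-bcd)

  order-3412 : ∀ {a b c d} → c < d → d < a → a < b → iso4 p3412 a b c d ≡ true
  order-3412 {a} {b} {c} {d} cd da ab
    rewrite <⇒<ᵇ≡true ab | ≤⇒<ᵇ≡false (<⇒≤ ab)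
          | <⇒<ᵇ≡true (<-trans cd da) | ≤⇒<ᵇ≡false (<⇒≤ (<-trans cd da))
          | <⇒<ᵇ≡true da | ≤⇒<ᵇ≡false (<⇒≤ da)
          | <⇒<ᵇ≡true (<-trans (<-trans cd da) ab) | ≤⇒<ᵇ≡false (<⇒≤ (<-trans (<-trans cd da) ab))
          | <⇒<ᵇ≡true (<-trans da ab) | ≤⇒<ᵇ≡false (<⇒≤ (<-trans da ab))
          | <⇒<ᵇ≡true cd | ≤⇒<ᵇ≡false (<⇒≤ cd) = refl



-- Let σ = L ++ R have all entries below m.  Then
-- L ++ m ∷ R avoids {1324, 1342, 3412} iff σ does and the gap (L, R) is
-- active: L has no 132, no x < z < y with x before y in L and z in R (a
-- 1342 through m), and no a < b < y with y in L and a before b in R (a 3412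
-- through m).  Since m is maximal it can only play the role of the 4.
module MaxInsertion where

  open import Data.Nat using (zero; suc; _<_; _<ᵇ_)
  open import Data.Nat.Properties using (<-asym)
  open import Data.Bool using (Bool; true; false; _∧_; _∨_; not)
  open import Data.Bool.Properties using (∨-identityʳ; ∧-identityʳ; ∧-idempotentCommutativeMonoid)
  open import Data.Bool.ListAction using (any)
  open import Data.Empty using (⊥-elim)
  open import Data.Product using (_×_; _,_; proj₁; proj₂)
  open import Data.List using (_++_; length)
  open import Data.List.Relation.Unary.All as All using (All; []; _∷_)
  import Data.List.Relation.Unary.All.Properties as AllP
  open import Relation.Binary.PropositionalEquality
  open import Function using (_∘_)
  import Algebra.Solver.IdempotentCommutativeMonoid as ICM
  open Occurrences
  open PatternOrder

  patterns : List (List ℕ)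
  patterns = p1324 ∷ p1342 ∷ p3412 ∷ []

  has132 : List ℕ → Bool
  has132 L = occurs 3 (λ a b c → (a <ᵇ c) ∧ (c <ᵇ b)) L

  has13-2 : List ℕ → List ℕ → Bool
  has13-2 L R = occurs 2 (λ x y → occurs 1 (λ z → (x <ᵇ z) ∧ (z <ᵇ y)) R) L

  has3-12 : List ℕ → List ℕ → Bool
  has3-12 L R = occurs 1 (λ y → occurs 2 (λ a b → (a <ᵇ b) ∧ (b <ᵇ y)) R) L

  active : List ℕ → List ℕ → Bool
  active L R = not (has132 L) ∧ (not (has13-2 L R) ∧ not (has3-12 L R))

  subseqs-length : ∀ k xs → All (λ s → length s ≡ k) (subseqs k xs)
  subseqs-length zero    xs       = refl ∷ []
  subseqs-length (suc k) []       = []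
  subseqs-length (suc k) (x ∷ xs) =
    AllP.++⁺ (AllP.map⁺ (All.map (cong suc) (subseqs-length k xs))) (subseqs-length (suc k) xs)

  any-congAll : ∀ {P : List ℕ → Set} (f g : List ℕ → Bool) {xs} → All P xs → (∀ s → P s → f s ≡ g s) → any f xs ≡ any g xs
  any-congAll f g []       h = refl
  any-congAll f g (p ∷ ps) h = cong₂ _∨_ (h _ p) (any-congAll f g ps h)

  contains≡occurs : ∀ τ π → length τ ≡ 4 → contains π τ ≡ occurs 4 (iso4 τ) π
  contains≡occurs τ@(_ ∷ _ ∷ _ ∷ _ ∷ []) π refl =
    trans (any-congAll (λ s → orderIso s τ) (applyTo 4 (iso4 τ)) (subseqs-length 4 π) four-entries)
          (any-subseqs 4 (iso4 τ) π)
    where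
    four-entries : ∀ s → length s ≡ 4 → orderIso s τ ≡ applyTo 4 (iso4 τ) s
    four-entries (_ ∷ _ ∷ _ ∷ _ ∷ []) refl = refl

  ∧-split : ∀ x y → x ∧ y ≡ true → (x ≡ true) × (y ≡ true)
  ∧-split true true e = refl , refl

  ∧-intro : ∀ {x y} → x ≡ true → y ≡ true → x ∧ y ≡ true
  ∧-intro refl refl = refl

  not-∨ : ∀ x y → not (x ∨ y) ≡ not x ∧ not y
  not-∨ true  y = refl
  not-∨ false y = refl

  not-∨-split : ∀ a₁ a₂ a₃ x y z → not (a₁ ∨ x) ∧ (not (a₂ ∨ y) ∧ not (a₃ ∨ z))
                                 ≡ (not a₁ ∧ (not a₂ ∧ not a₃)) ∧ (not x ∧ (not y ∧ not z))
  not-∨-split a₁ a₂ a₃ x y z =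
    trans (cong₂ _∧_ (not-∨ a₁ x) (cong₂ _∧_ (not-∨ a₂ y) (not-∨ a₃ z)))
          (solve 6 (λ a₁ a₂ a₃ x y z → (a₁ ⊕ x) ⊕ ((a₂ ⊕ y) ⊕ (a₃ ⊕ z)) ⊜ (a₁ ⊕ (a₂ ⊕ a₃)) ⊕ (x ⊕ (y ⊕ z))) refl
                 (not a₁) (not a₂) (not a₃) (not x) (not y) (not z))
    where open ICM ∧-idempotentCommutativeMonoid using (solve; _⊕_; _⊜_)

  avoids≡ : ∀ π → avoidsAll patterns π
              ≡ not (occurs 4 (iso4 p1324) π) ∧ (not (occurs 4 (iso4 p1342) π) ∧ not (occurs 4 (iso4 p3412) π))
  avoids≡ π = cong₂ (λ u v → not u ∧ v) (contains≡occurs p1324 π refl)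
               (cong₂ (λ u v → not u ∧ v) (contains≡occurs p1342 π refl)
                      (trans (cong (λ u → not u ∧ true) (contains≡occurs p3412 π refl)) (∧-identityʳ _)))

  module InsertMax (m : ℕ) where
    open Insertion m

    refuted : ∀ {b : Bool} {x} → (b ≡ true → m < x) → x < m → b ≡ false
    refuted {false} f x<m = refl
    refuted {true}  f x<m = ⊥-elim (<-asym (f refl) x<m)

    characterised : ∀ {b : Bool} {x y z} → (b ≡ true → x < y × y < z) → (x < y → y < z → b ≡ true) →
                    b ≡ (x <ᵇ y) ∧ (y <ᵇ z)
    characterised {x = x} {y} {z} ⇒ ⇐ = bool-ext
      (λ e → ∧-intro (<⇒<ᵇ≡true (proj₁ (⇒ e))) (<⇒<ᵇ≡true (proj₂ (⇒ e))))
      (λ e → ⇐ (<ᵇ≡true⇒< (proj₁ (∧-split (x <ᵇ y) (y <ᵇ z) e))) (<ᵇ≡true⇒< (proj₂ (∧-split (x <ᵇ y) (y <ᵇ z) e))))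

    insert-1324 : ∀ L R → All (_< m) L → All (_< m) R →
      occurs 4 (iso4 p1324) (L ++ m ∷ R) ≡ occurs 4 (iso4 p1324) (L ++ R) ∨ has132 L
    insert-1324 L R aL aR = trans (occurs-insert 4 f L R) (cong (occurs 4 f (L ++ R) ∨_)
      (trans (occursUsing₄ f L R) (cong₂ _∨_ m-as-1 (cong₂ _∨_ m-as-3 (cong₂ _∨_ m-as-2 m-as-4)))))
      where
      f : Pred 4
      f = iso4 p1324
      m-as-1 : occurs 3 (f m) R ≡ false
      m-as-1 = occurs-false 3 _ R aR (λ b _ c hc d _ → refuted (proj₁ ∘ 1324-order m b c d) hc)
      m-as-3 : occurs 1 (λ a → occurs 2 (f a m) R) L ≡ false
      m-as-3 = occurs-false 1 _ L aL (λ a _ → occurs-false 2 _ R aR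
                 (λ c _ d hd → refuted (proj₂ ∘ proj₂ ∘ 1324-order a m c d) hd))
      m-as-2 : occurs 2 (λ a b → occurs 1 (f a b m) R) L ≡ false
      m-as-2 = occurs-false 2 _ L aL (λ a _ b hb → occurs-false 1 _ R aR
                 (λ d _ → refuted (proj₁ ∘ proj₂ ∘ 1324-order a b m d) hb))
      m-as-4 : occurs 3 (λ a b c → f a b c m) L ≡ has132 L
      m-as-4 = occurs-congBelow 3 _ _ L aL (λ a _ b hb c _ →
                 characterised (λ e → proj₁ (1324-order a b c m e) , proj₁ (proj₂ (1324-order a b c m e)))
                               (λ ac cb → order-1324 ac cb hb))

    insert-1342 : ∀ L R → All (_< m) L → All (_< m) R →
      occurs 4 (iso4 p1342) (L ++ m ∷ R) ≡ occurs 4 (iso4 p1342) (L ++ R) ∨ has13-2 L R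
    insert-1342 L R aL aR = trans (occurs-insert 4 f L R) (cong (occurs 4 f (L ++ R) ∨_)
      (trans (occursUsing₄ f L R)
             (trans (cong₂ _∨_ m-as-1 (cong₂ _∨_ m-as-3 (cong₂ _∨_ m-as-4 m-as-2))) (∨-identityʳ (has13-2 L R)))))
      where
      f : Pred 4
      f = iso4 p1342
      m-as-1 : occurs 3 (f m) R ≡ false
      m-as-1 = occurs-false 3 _ R aR (λ b _ c _ d hd → refuted (proj₁ ∘ 1342-order m b c d) hd)
      m-as-3 : occurs 1 (λ a → occurs 2 (f a m) R) L ≡ false
      m-as-3 = occurs-false 1 _ L aL (λ a _ → occurs-false 2 _ R aR
                 (λ c hc d _ → refuted (proj₂ ∘ proj₂ ∘ 1342-order a m c d) hc))
      m-as-4 : occurs 2 (λ a b → occurs 1 (f a b m) R) L ≡ has13-2 L R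
      m-as-4 = occurs-congBelow 2 _ _ L aL (λ a _ b hb → occurs-congBelow 1 _ _ R aR (λ d _ →
                 characterised (λ e → proj₁ (1342-order a b m d e) , proj₁ (proj₂ (1342-order a b m d e)))
                               (λ ad db → order-1342 ad db hb)))
      m-as-2 : occurs 3 (λ a b c → f a b c m) L ≡ false
      m-as-2 = occurs-false 3 _ L aL (λ a _ b hb c _ → refuted (proj₁ ∘ proj₂ ∘ 1342-order a b c m) hb)

    insert-3412 : ∀ L R → All (_< m) L → All (_< m) R →
      occurs 4 (iso4 p3412) (L ++ m ∷ R) ≡ occurs 4 (iso4 p3412) (L ++ R) ∨ has3-12 L R
    insert-3412 L R aL aR = trans (occurs-insert 4 f L R) (cong (occurs 4 f (L ++ R) ∨_)
      (trans (occursUsing₄ f L R)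
             (trans (cong₂ _∨_ m-as-3 (cong₂ _∨_ m-as-4 (cong₂ _∨_ m-as-1 m-as-2))) (∨-identityʳ (has3-12 L R)))))
      where
      f : Pred 4
      f = iso4 p3412
      m-as-3 : occurs 3 (f m) R ≡ false
      m-as-3 = occurs-false 3 _ R aR (λ b hb c _ d _ → refuted (proj₂ ∘ proj₂ ∘ 3412-order m b c d) hb)
      m-as-4 : occurs 1 (λ a → occurs 2 (f a m) R) L ≡ has3-12 L R
      m-as-4 = occurs-congBelow 1 _ _ L aL (λ a ha → occurs-congBelow 2 _ _ R aR (λ c _ d _ →
                 characterised (λ e → proj₁ (3412-order a m c d e) , proj₁ (proj₂ (3412-order a m c d e)))
                               (λ cd da → order-3412 cd da ha)))
      m-as-1 : occurs 2 (λ a b → occurs 1 (f a b m) R) L ≡ false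
      m-as-1 = occurs-false 2 _ L aL (λ a _ b _ → occurs-false 1 _ R aR
                 (λ d hd → refuted (proj₁ ∘ 3412-order a b m d) hd))
      m-as-2 : occurs 3 (λ a b c → f a b c m) L ≡ false
      m-as-2 = occurs-false 3 _ L aL (λ a ha b _ c _ → refuted (proj₁ ∘ proj₂ ∘ 3412-order a b c m) ha)

    avoids-insert : ∀ L R → All (_< m) L → All (_< m) R →
      avoidsAll patterns (L ++ m ∷ R) ≡ avoidsAll patterns (L ++ R) ∧ active L R
    avoids-insert L R aL aR = begin
        avoidsAll patterns (L ++ m ∷ R)
      ≡⟨ avoids≡ (L ++ m ∷ R) ⟩
        not (O p1324 (L ++ m ∷ R)) ∧ (not (O p1342 (L ++ m ∷ R)) ∧ not (O p3412 (L ++ m ∷ R)))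
      ≡⟨ cong₂ (λ u v → not u ∧ v) (insert-1324 L R aL aR)
               (cong₂ (λ u v → not u ∧ not v) (insert-1342 L R aL aR) (insert-3412 L R aL aR)) ⟩
        not (O p1324 (L ++ R) ∨ has132 L) ∧ (not (O p1342 (L ++ R) ∨ has13-2 L R) ∧ not (O p3412 (L ++ R) ∨ has3-12 L R))
      ≡⟨ not-∨-split (O p1324 (L ++ R)) (O p1342 (L ++ R)) (O p3412 (L ++ R)) (has132 L) (has13-2 L R) (has3-12 L R) ⟩
        (not (O p1324 (L ++ R)) ∧ (not (O p1342 (L ++ R)) ∧ not (O p3412 (L ++ R)))) ∧ active L R
      ≡⟨ cong (_∧ active L R) (avoids≡ (L ++ R)) ⟨
        avoidsAll patterns (L ++ R) ∧ active L R
      ∎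
      where
      open ≡-Reasoning
      O : List ℕ → List ℕ → Bool
      O τ = occurs 4 (iso4 τ)

module ActiveGaps where

  open import Data.Nat using (_<_; _<ᵇ_)
  open import Data.Nat.Properties using (<⇒≤)
  open import Data.Bool using (Bool; true; false; _∧_; _∨_; not)
  open import Data.Bool.Properties using (∨-identityʳ; ∨-zeroʳ; ∧-zeroʳ; ∧-identityʳ; ∨-assoc; ∧-assoc; ∨-idempotentCommutativeMonoid)
  open import Data.List using (_++_; null)
  open import Data.List.Relation.Unary.All using (All; []; _∷_)
  open import Relation.Binary.PropositionalEquality
  import Algebra.Solver.IdempotentCommutativeMonoid as ICM
  open Occurrences
  open PatternOrder
  open MaxInsertion

  ascentAcross : List ℕ → List ℕ → Bool
  ascentAcross L R = occurs 1 (λ x → occurs 1 (λ z → x <ᵇ z) R) L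

  above : List ℕ → List ℕ → Bool
  above L R = not (ascentAcross L R)

  decreasing : List ℕ → Bool
  decreasing R = not (occurs 2 _<ᵇ_ R)

  occurs₁-++ : ∀ f A B → occurs 1 f (A ++ B) ≡ occurs 1 f A ∨ occurs 1 f B
  occurs₁-++ f []      B = refl
  occurs₁-++ f (x ∷ A) B = trans (cong (f x ∨_) (occurs₁-++ f A B)) (sym (∨-assoc (f x) (occurs 1 f A) (occurs 1 f B)))

  occurs₁-∨ : ∀ p q L → occurs 1 (λ x → p x ∨ q x) L ≡ occurs 1 p L ∨ occurs 1 q L
  occurs₁-∨ p q []      = refl
  occurs₁-∨ p q (x ∷ L) = trans (cong ((p x ∨ q x) ∨_) (occurs₁-∨ p q L))
    (solve 4 (λ a b c d → (a ⊕ b) ⊕ (c ⊕ d) ⊜ (a ⊕ c) ⊕ (b ⊕ d)) refl (p x) (q x) (occurs 1 p L) (occurs 1 q L))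
    where open ICM ∨-idempotentCommutativeMonoid using (solve; _⊕_; _⊜_)

  active-split : ∀ c b c′ x₁ x₂ x₃ → not (c ∨ x₁) ∧ (not (b ∨ x₂) ∧ not (c′ ∨ x₃))
                                  ≡ (not c ∧ (not b ∧ not c′)) ∧ (not (x₁ ∨ x₂) ∧ not x₃)
  active-split c b c′ x₁ x₂ x₃ =
    trans (not-∨-split c b c′ x₁ x₂ x₃)
          (cong ((not c ∧ (not b ∧ not c′)) ∧_)
                (trans (sym (∧-assoc (not x₁) (not x₂) (not x₃))) (cong (_∧ not x₃) (sym (not-∨ x₁ x₂)))))

  module ActiveUnderInsertion (m : ℕ) where
    open Insertion m

    <ᵇm : ∀ {x} → x < m → (x <ᵇ m) ≡ true
    <ᵇm = <⇒<ᵇ≡true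
    m≮ᵇ : ∀ {x} → x < m → (m <ᵇ x) ≡ false
    m≮ᵇ p = ≤⇒<ᵇ≡false (<⇒≤ p)

    ascentAcross-++ : ∀ L R₁ R₂ → All (_< m) L → ascentAcross L (R₁ ++ R₂) ≡ ascentAcross L R₁ ∨ ascentAcross L R₂
    ascentAcross-++ L R₁ R₂ aL =
      trans (occurs-congBelow 1 _ _ L aL (λ x _ → occurs₁-++ (x <ᵇ_) R₁ R₂))
            (occurs₁-∨ (λ x → occurs 1 (x <ᵇ_) R₁) (λ x → occurs 1 (x <ᵇ_) R₂) L)

    -- m inserted right of the gap can only create patterns with m as its
    -- top entry, which active already excludes
    active-insertRight : ∀ L X Y → All (_< m) L → All (_< m) X → All (_< m) Y →
                         active L (X ++ m ∷ Y) ≡ active L (X ++ Y)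
    active-insertRight L X Y aL aX aY = cong₂ (λ u v → not (has132 L) ∧ (not u ∧ not v)) 13-2-same 3-12-same
      where
      13-2-same : has13-2 L (X ++ m ∷ Y) ≡ has13-2 L (X ++ Y)
      13-2-same = occurs-congBelow 2 _ _ L aL (λ x _ y hy →
        trans (occurs-insert 1 (λ z → (x <ᵇ z) ∧ (z <ᵇ y)) X Y)
        (trans (cong (occurs 1 (λ z → (x <ᵇ z) ∧ (z <ᵇ y)) (X ++ Y) ∨_)
                     (trans (occursUsing₁ (λ z → (x <ᵇ z) ∧ (z <ᵇ y)) X Y)
                            (trans (cong ((x <ᵇ m) ∧_) (m≮ᵇ hy)) (∧-zeroʳ _))))
               (∨-identityʳ _)))
      3-12-same : has3-12 L (X ++ m ∷ Y) ≡ has3-12 L (X ++ Y)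
      3-12-same = occurs-congBelow 1 _ _ L aL (λ y hy →
        trans (occurs-insert 2 (λ a b → (a <ᵇ b) ∧ (b <ᵇ y)) X Y)
        (trans (cong (occurs 2 (λ a b → (a <ᵇ b) ∧ (b <ᵇ y)) (X ++ Y) ∨_)
                     (trans (occursUsing₂ (λ a b → (a <ᵇ b) ∧ (b <ᵇ y)) X Y)
                            (cong₂ _∨_ (occurs-false 1 _ Y aY (λ b hb → cong (_∧ (b <ᵇ y)) (m≮ᵇ hb)))
                                       (occurs-false 1 _ X aX (λ a _ → trans (cong ((a <ᵇ m) ∧_) (m≮ᵇ hy)) (∧-zeroʳ _))))))
               (∨-identityʳ _)))

    above-insertRight : ∀ L X Y → All (_< m) L → above L (X ++ m ∷ Y) ≡ null L
    above-insertRight []      X Y aL        = refl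
    above-insertRight (x ∷ L) X Y (hx ∷ aL) =
      cong (λ u → not (u ∨ ascentAcross L (X ++ m ∷ Y)))
        (trans (occurs-insert 1 (x <ᵇ_) X Y)
               (trans (cong (occurs 1 (x <ᵇ_) (X ++ Y) ∨_) (trans (occursUsing₁ (x <ᵇ_) X Y) (<ᵇm hx))) (∨-zeroʳ _)))

    decreasing-insert : ∀ X R → All (_< m) X → All (_< m) R → decreasing (X ++ m ∷ R) ≡ null X ∧ decreasing R
    decreasing-insert []      R aX        aR =
      cong (λ u → not (u ∨ occurs 2 _<ᵇ_ R)) (occurs-false 1 _ R aR (λ z hz → m≮ᵇ hz))
    decreasing-insert (x ∷ X) R (hx ∷ aX) aR =
      cong (λ u → not (u ∨ occurs 2 _<ᵇ_ (X ++ m ∷ R)))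
        (trans (occurs-insert 1 (x <ᵇ_) X R)
               (trans (cong (occurs 1 (x <ᵇ_) (X ++ R) ∨_) (trans (occursUsing₁ (x <ᵇ_) X R) (<ᵇm hx))) (∨-zeroʳ _)))

    above-insertLeft : ∀ L R₁ R₂ → All (_< m) R₂ → above (L ++ m ∷ R₁) R₂ ≡ above (L ++ R₁) R₂
    above-insertLeft L R₁ R₂ a₂ = cong not
      (trans (occurs-insert 1 (λ x → occurs 1 (x <ᵇ_) R₂) L R₁)
      (trans (cong (ascentAcross (L ++ R₁) R₂ ∨_)
                   (trans (occursUsing₁ (λ x → occurs 1 (x <ᵇ_) R₂) L R₁) (occurs-false 1 _ R₂ a₂ (λ z hz → m≮ᵇ hz))))
             (∨-identityʳ _)))

    -- m inserted left of the gap (L, R₂), between L and R₁: it creates a 132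
    -- with an ascent from L to R₁, a 13-2 with an ascent from L to R₂, and a
    -- 3-12 with an ascent inside R₂
    active-insertLeft : ∀ L R₁ R₂ → All (_< m) L → All (_< m) R₁ → All (_< m) R₂ →
      active (L ++ m ∷ R₁) R₂ ≡ active (L ++ R₁) R₂ ∧ (above L (R₁ ++ R₂) ∧ decreasing R₂)
    active-insertLeft L R₁ R₂ aL a₁ a₂ = begin
        active (L ++ m ∷ R₁) R₂
      ≡⟨ cong₂ (λ u v → not u ∧ v) 132-new (cong₂ (λ u v → not u ∧ not v) 13-2-new 3-12-new) ⟩
        not (has132 (L ++ R₁) ∨ ascentAcross L R₁) ∧ (not (has13-2 (L ++ R₁) R₂ ∨ ascentAcross L R₂)
                                                     ∧ not (has3-12 (L ++ R₁) R₂ ∨ occurs 2 _<ᵇ_ R₂))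
      ≡⟨ active-split (has132 (L ++ R₁)) (has13-2 (L ++ R₁) R₂) (has3-12 (L ++ R₁) R₂)
                      (ascentAcross L R₁) (ascentAcross L R₂) (occurs 2 _<ᵇ_ R₂) ⟩
        active (L ++ R₁) R₂ ∧ (not (ascentAcross L R₁ ∨ ascentAcross L R₂) ∧ decreasing R₂)
      ≡⟨ cong (λ u → active (L ++ R₁) R₂ ∧ (not u ∧ decreasing R₂)) (ascentAcross-++ L R₁ R₂ aL) ⟨
        active (L ++ R₁) R₂ ∧ (above L (R₁ ++ R₂) ∧ decreasing R₂)
      ∎
      where
      open ≡-Reasoning
      132-pred : Pred 3
      132-pred a b c = (a <ᵇ c) ∧ (c <ᵇ b)
      132-new : has132 (L ++ m ∷ R₁) ≡ has132 (L ++ R₁) ∨ ascentAcross L R₁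
      132-new = trans (occurs-insert 3 132-pred L R₁) (cong (has132 (L ++ R₁) ∨_) (trans (occursUsing₃ 132-pred L R₁)
        (trans (cong₂ (λ u v → u ∨ (occurs 1 (λ a → occurs 1 (132-pred a m) R₁) L ∨ v))
                      (occurs-false 2 _ R₁ a₁ (λ b _ c hc → cong (_∧ (c <ᵇ b)) (m≮ᵇ hc)))
                      (occurs-false 2 _ L aL (λ a _ b hb → trans (cong ((a <ᵇ m) ∧_) (m≮ᵇ hb)) (∧-zeroʳ _))))
        (trans (∨-identityʳ _) (occurs-congBelow 1 _ _ L aL (λ a _ → occurs-congBelow 1 _ _ R₁ a₁
                 (λ c hc → trans (cong ((a <ᵇ c) ∧_) (<ᵇm hc)) (∧-identityʳ _))))))))
      13-2-pred : Pred 2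
      13-2-pred x y = occurs 1 (λ z → (x <ᵇ z) ∧ (z <ᵇ y)) R₂
      13-2-new : has13-2 (L ++ m ∷ R₁) R₂ ≡ has13-2 (L ++ R₁) R₂ ∨ ascentAcross L R₂
      13-2-new = trans (occurs-insert 2 13-2-pred L R₁) (cong (has13-2 (L ++ R₁) R₂ ∨_) (trans (occursUsing₂ 13-2-pred L R₁)
        (cong₂ _∨_ (occurs-false 1 _ R₁ a₁ (λ b _ → occurs-false 1 _ R₂ a₂ (λ z hz → cong (_∧ (z <ᵇ b)) (m≮ᵇ hz))))
                   (occurs-congBelow 1 _ _ L aL (λ a _ → occurs-congBelow 1 _ _ R₂ a₂
                      (λ z hz → trans (cong ((a <ᵇ z) ∧_) (<ᵇm hz)) (∧-identityʳ _)))))))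
      3-12-pred : Pred 1
      3-12-pred y = occurs 2 (λ a b → (a <ᵇ b) ∧ (b <ᵇ y)) R₂
      3-12-new : has3-12 (L ++ m ∷ R₁) R₂ ≡ has3-12 (L ++ R₁) R₂ ∨ occurs 2 _<ᵇ_ R₂
      3-12-new = trans (occurs-insert 1 3-12-pred L R₁) (cong (has3-12 (L ++ R₁) R₂ ∨_) (trans (occursUsing₁ 3-12-pred L R₁)
        (occurs-congBelow 2 _ _ R₂ a₂ (λ a _ b hb → trans (cong ((a <ᵇ b) ∧_) (<ᵇm hb)) (∧-identityʳ _)))))

module ListFacts where

  open import Data.Bool using (Bool; true; false; _∧_)
  open import Data.List using (_++_; map; filterᵇ)
  open import Data.List.Properties using (map-cong-local; filter-++)
  import Data.List.Properties as LP
  open import Data.List.Relation.Unary.All as All using (All; []; _∷_)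
  open import Relation.Binary.PropositionalEquality
  open import Relation.Nullary.Decidable using (T?)
  open import Function using (_∘_)

  module _ {A B : Set} where

    map-map : (f : A → B) {C : Set} (g : C → A) (xs : List C) → map f (map g xs) ≡ map (f ∘ g) xs
    map-map f g xs = sym (LP.map-∘ xs)

    map-congAll : {P : A → Set} (f g : A → B) {xs : List A} → All P xs → (∀ x → P x → f x ≡ g x) →
                  map f xs ≡ map g xs
    map-congAll f g ps h = map-cong-local (All.map (λ {x} → h x) ps)

    filterᵇ-map : (p : B → Bool) (f : A → B) (xs : List A) → filterᵇ p (map f xs) ≡ map f (filterᵇ (p ∘ f) xs)
    filterᵇ-map p f []       = refl
    filterᵇ-map p f (x ∷ xs) with p (f x)
    ... | true  = cong (f x ∷_) (filterᵇ-map p f xs)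
    ... | false = filterᵇ-map p f xs

  module _ {A : Set} where

    filterᵇ-congAll : {P : A → Set} (p q : A → Bool) {xs : List A} → All P xs → (∀ x → P x → p x ≡ q x) →
                      filterᵇ p xs ≡ filterᵇ q xs
    filterᵇ-congAll p q []                   h = refl
    filterᵇ-congAll p q {x ∷ xs} (px ∷ ps) h rewrite h x px with q x
    ... | true  = cong (x ∷_) (filterᵇ-congAll p q ps h)
    ... | false = filterᵇ-congAll p q ps h

    filterᵇ-cong : (p q : A → Bool) (xs : List A) → (∀ x → p x ≡ q x) → filterᵇ p xs ≡ filterᵇ q xs
    filterᵇ-cong p q xs h = filterᵇ-congAll {P = λ _ → A} p q (All.universal (λ x → x) xs) (λ x _ → h x)

    filterᵇ-accept : (p : A → Bool) {x : A} (xs : List A) → p x ≡ true → filterᵇ p (x ∷ xs) ≡ x ∷ filterᵇ p xs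
    filterᵇ-accept p xs px rewrite px = refl

    filterᵇ-All : {P : A → Set} (p : A → Bool) {xs : List A} → All P xs → All P (filterᵇ p xs)
    filterᵇ-All p []                = []
    filterᵇ-All p {x ∷ xs} (px ∷ ps) with p x
    ... | true  = px ∷ filterᵇ-All p ps
    ... | false = filterᵇ-All p ps

    filterᵇ-true : (p : A → Bool) (xs : List A) → All (λ x → p x ≡ true) (filterᵇ p xs)
    filterᵇ-true p []       = []
    filterᵇ-true p (x ∷ xs) with p x in eq
    ... | true  = eq ∷ filterᵇ-true p xs
    ... | false = filterᵇ-true p xs

    filterᵇ-++ : (p : A → Bool) (xs ys : List A) → filterᵇ p (xs ++ ys) ≡ filterᵇ p xs ++ filterᵇ p ys
    filterᵇ-++ p = filter-++ (T? ∘ p)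

    filterᵇ-filterᵇ : (p q : A → Bool) (xs : List A) → filterᵇ q (filterᵇ p xs) ≡ filterᵇ (λ x → p x ∧ q x) xs
    filterᵇ-filterᵇ p q []       = refl
    filterᵇ-filterᵇ p q (x ∷ xs) with p x
    ... | false = filterᵇ-filterᵇ p q xs
    ... | true with q x
    ...   | true  = cong (x ∷_) (filterᵇ-filterᵇ p q xs)
    ...   | false = filterᵇ-filterᵇ p q xs

    filterᵇ-none : (p : A → Bool) (xs : List A) → (∀ x → p x ≡ false) → filterᵇ p xs ≡ []
    filterᵇ-none p []       h = refl
    filterᵇ-none p (x ∷ xs) h rewrite h x = filterᵇ-none p xs h

module Gaps where

  open import Data.Product using (_×_; _,_; proj₁; proj₂)
  open import Data.List using (_++_; map)
  open import Data.List.Properties using (map-++)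
  open import Data.List.Relation.Unary.All using (All; []; _∷_)
  open import Relation.Binary.PropositionalEquality
  open ListFacts

  Gap : Set
  Gap = List ℕ × List ℕ

  extendLeft : ℕ → Gap → Gap
  extendLeft x p = (x ∷ proj₁ p , proj₂ p)

  gaps : List ℕ → List Gap
  gaps []       = ([] , []) ∷ []
  gaps (x ∷ xs) = ([] , x ∷ xs) ∷ map (extendLeft x) (gaps xs)

  insertAt : ℕ → Gap → List ℕ
  insertAt m p = proj₁ p ++ m ∷ proj₂ p

  gaps-split : ∀ σ → All (λ p → proj₁ p ++ proj₂ p ≡ σ) (gaps σ)
  gaps-split []      = refl ∷ []
  gaps-split (x ∷ σ) = refl ∷ extend (gaps σ) (gaps-split σ)
    where
    extend : ∀ ps → All (λ p → proj₁ p ++ proj₂ p ≡ σ) ps →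
             All (λ p → proj₁ p ++ proj₂ p ≡ x ∷ σ) (map (extendLeft x) ps)
    extend []       []       = []
    extend (p ∷ ps) (e ∷ es) = cong (x ∷_) e ∷ extend ps es

  insertions≡gaps : ∀ m σ → insertions m σ ≡ map (insertAt m) (gaps σ)
  insertions≡gaps m []       = refl
  insertions≡gaps m (y ∷ ys) = cong ((m ∷ y ∷ ys) ∷_)
    (trans (cong (map (y ∷_)) (insertions≡gaps m ys))
    (trans (map-map (y ∷_) (insertAt m) (gaps ys)) (sym (map-map (insertAt m) (extendLeft y) (gaps ys)))))

  gaps-insert : ∀ m L R → gaps (L ++ m ∷ R)
    ≡ map (λ p → (proj₁ p , proj₂ p ++ m ∷ R)) (gaps L) ++ map (λ p → (L ++ m ∷ proj₁ p , proj₂ p)) (gaps R)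
  gaps-insert m []      R = refl
  gaps-insert m (x ∷ L) R = cong (([] , x ∷ L ++ m ∷ R) ∷_)
    (trans (cong (map (extendLeft x)) (gaps-insert m L R))
    (trans (map-++ (extendLeft x) (map f (gaps L)) (map g (gaps R)))
      (cong₂ _++_ (trans (map-map (extendLeft x) f (gaps L)) (sym (map-map f (extendLeft x) (gaps L))))
                  (map-map (extendLeft x) g (gaps R)))))
    where
    f : Gap → Gap
    f p = (proj₁ p , proj₂ p ++ m ∷ R)
    g : Gap → Gap
    g p = (L ++ m ∷ proj₁ p , proj₂ p)

-- When m is inserted into an active gap, the
-- active gaps left of m get the flags computed by leftFlags; the right ones
-- survive only when the gap was `above`, and then exactly the decreasing
-- ones survive (LabelRecurrence).  childLabels is this rule on labels.
module Labels where

  open import Data.Nat using (zero; suc)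
  open import Data.Nat.Properties using (suc-injective)
  open import Data.Bool using (Bool; true; false; _∧_; if_then_else_)
  open import Data.Product using (_×_; _,_; proj₁; proj₂; Σ)
  open import Data.List using (_++_; map; length; null; filterᵇ)
  open import Data.List.Properties using (length-map)
  open import Relation.Binary.PropositionalEquality
  open import Function using (_∘_)
  open MaxInsertion
  open ActiveGaps
  open ListFacts
  open Gaps

  Flag : Set
  Flag = Bool × Bool

  activeGap : Gap → Bool
  activeGap p = active (proj₁ p) (proj₂ p)

  flag : Gap → Flag
  flag p = (above (proj₁ p) (proj₂ p) , decreasing (proj₂ p))

  label : List ℕ → List Flag
  label σ = map flag (filterᵇ activeGap (gaps σ))

  -- leftFlags k d: the flags of the k+1 active gaps left of a newly inserted
  -- maximum; only the first lies above, only the last can be decreasing (iff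
  -- d).  leftFlags′ k d are the flags after the first one.
  leftFlags′ : ℕ → Bool → List Flag
  leftFlags′ zero    d = (false , d) ∷ []
  leftFlags′ (suc k) d = (false , false) ∷ leftFlags′ k d

  leftFlags : ℕ → Bool → List Flag
  leftFlags zero    d = (true , d) ∷ []
  leftFlags (suc k) d = (true , false) ∷ leftFlags′ k d

  markDecreasing : Flag → Flag
  markDecreasing x = (proj₁ x , true)

  -- the label after inserting into the active gap with flag x, which has k
  -- active gaps to its left and post to its right
  childLabel : ℕ → Flag → List Flag → List Flag
  childLabel k x post = leftFlags k (proj₂ x) ++ (if proj₁ x then map markDecreasing (filterᵇ proj₂ (x ∷ post)) else [])

  childLabelsFrom : ℕ → List Flag → List (List Flag)
  childLabelsFrom k [] = []
  childLabelsFrom k (x ∷ post) = childLabel k x post ∷ childLabelsFrom (suc k) post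

  childLabels : List Flag → List (List Flag)
  childLabels = childLabelsFrom 0

  length-filter-extendLeft : ∀ x L (Q : Gap → Bool) →
    length (filterᵇ Q (map (extendLeft x) (gaps L))) ≡ length (filterᵇ (Q ∘ extendLeft x) (gaps L))
  length-filter-extendLeft x L Q =
    trans (cong length (filterᵇ-map Q (extendLeft x) (gaps L)))
          (length-map (extendLeft x) (filterᵇ (Q ∘ extendLeft x) (gaps L)))

  active-count-pos : ∀ L (Q : Gap → Bool) → Q (L , []) ≡ true → Σ ℕ (λ k → length (filterᵇ Q (gaps L)) ≡ suc k)
  active-count-pos []      Q q rewrite q = 0 , refl
  active-count-pos (x ∷ L) Q q with Q ([] , x ∷ L)
  ... | true  = length (filterᵇ Q (map (extendLeft x) (gaps L))) , refl
  ... | false with active-count-pos L (Q ∘ extendLeft x) q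
  ...   | k , e = k , trans (length-filter-extendLeft x L Q) e

  -- the gaps of L that stay active left of m: none but the first lies above,
  -- and only the last can be decreasing (flags written in terms of L)
  leftFlags′-correct : ∀ L (Q : Gap → Bool) d k → Q (L , []) ≡ true → length (filterᵇ Q (gaps L)) ≡ suc k →
    map (λ p → (false , null (proj₂ p) ∧ d)) (filterᵇ Q (gaps L)) ≡ leftFlags′ k d
  leftFlags′-correct []      Q d k q e rewrite q with e
  ... | refl = refl
  leftFlags′-correct (x ∷ L) Q d k q e with Q ([] , x ∷ L)
  ... | false rewrite filterᵇ-map Q (extendLeft x) (gaps L) =
    trans (map-map _ (extendLeft x) (filterᵇ (Q ∘ extendLeft x) (gaps L)))
          (leftFlags′-correct L (Q ∘ extendLeft x) d k q (trans (sym (length-map (extendLeft x) (filterᵇ (Q ∘ extendLeft x) (gaps L)))) e))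
  ... | true with active-count-pos L (Q ∘ extendLeft x) q
  ...   | k′ , e′ with trans (sym (suc-injective e)) (trans (length-filter-extendLeft x L Q) e′)
  ...     | refl rewrite filterᵇ-map Q (extendLeft x) (gaps L) =
    cong ((false , false) ∷_) (trans (map-map _ (extendLeft x) (filterᵇ (Q ∘ extendLeft x) (gaps L)))
                                     (leftFlags′-correct L (Q ∘ extendLeft x) d k′ q e′))

  leftFlags-correct : ∀ L (P : Gap → Bool) d k → P ([] , L) ≡ true → P (L , []) ≡ true →
    length (filterᵇ P (gaps L)) ≡ suc k →
    map (λ p → (null (proj₁ p) , null (proj₂ p) ∧ d)) (filterᵇ P (gaps L)) ≡ leftFlags k d
  leftFlags-correct []      P d k p0 p1 e rewrite p0 with e
  ... | refl = refl
  leftFlags-correct (x ∷ L) P d k p0 p1 e with active-count-pos L (P ∘ extendLeft x) p1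
  ... | k′ , e′ rewrite p0 with trans (sym (suc-injective e)) (trans (length-filter-extendLeft x L P) e′)
  ...   | refl rewrite filterᵇ-map P (extendLeft x) (gaps L) =
    cong ((true , false) ∷_) (trans (map-map _ (extendLeft x) (filterᵇ (P ∘ extendLeft x) (gaps L)))
                                    (leftFlags′-correct L (P ∘ extendLeft x) d k′ p1 e′))



module LabelRecurrence where

  open import Data.Nat using (suc; _<_; _+_)
  open import Data.Nat.Properties using (+-comm; +-identityʳ)
  open import Data.Bool using (Bool; true; false; _∧_; if_then_else_)
  open import Data.Bool.Properties using (∧-zeroʳ)
  open import Data.Product using (_,_; proj₁; proj₂)
  open import Data.List using (_++_; map; length; null; filterᵇ)
  open import Data.List.Properties using (map-++; ++-assoc; ++-identityʳ; length-++; length-map; map-id; map-cong)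
  open import Data.List.Relation.Unary.All using (All; []; _∷_)
  import Data.List.Relation.Unary.All.Properties as AllP
  open import Relation.Binary.PropositionalEquality
  open import Function using (_∘_)
  open MaxInsertion
  open ActiveGaps
  open ListFacts
  open Gaps
  open Labels

  avoids : List ℕ → Bool
  avoids = avoidsAll patterns

  gapsFrom : List ℕ → List ℕ → List Gap
  gapsFrom L []      = (L , []) ∷ []
  gapsFrom L (y ∷ R) = (L , y ∷ R) ∷ gapsFrom (L ++ y ∷ []) R

  gapsFrom≡ : ∀ L R → gapsFrom L R ≡ map (λ p → (L ++ proj₁ p , proj₂ p)) (gaps R)
  gapsFrom≡ L []      = cong (λ l → (l , []) ∷ []) (sym (++-identityʳ L))
  gapsFrom≡ L (y ∷ R) = cong₂ _∷_ (cong (_, y ∷ R) (sym (++-identityʳ L)))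
    (trans (gapsFrom≡ (L ++ y ∷ []) R)
    (trans (map-cong (λ p → cong (_, proj₂ p) (++-assoc L (y ∷ []) (proj₁ p))) (gaps R))
           (sym (map-map (λ p → (L ++ proj₁ p , proj₂ p)) (extendLeft y) (gaps R)))))

  gaps≡gapsFrom : ∀ σ → gaps σ ≡ gapsFrom [] σ
  gaps≡gapsFrom σ = sym (trans (gapsFrom≡ [] σ) (map-id (gaps σ)))

  activeLeft : List ℕ → List ℕ → ℕ
  activeLeft L R = length (filterᵇ (λ p → active (proj₁ p) (proj₂ p ++ R)) (gaps L))

  sucIf : Bool → ℕ → ℕ
  sucIf true  k = suc k
  sucIf false k = k

  activeLeft-snoc : ∀ L y R → activeLeft (L ++ y ∷ []) R ≡ sucIf (active (L ++ y ∷ []) R) (activeLeft L (y ∷ R))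
  activeLeft-snoc L y R = trans (cong (λ l → length (filterᵇ P l)) (gaps-insert y L []))
    (trans (cong length (filterᵇ-++ P (map f (gaps L)) ((L ++ y ∷ [] , []) ∷ [])))
    (trans (length-++ (filterᵇ P (map f (gaps L))))
    (trans (cong (_+ length (filterᵇ P ((L ++ y ∷ [] , []) ∷ []))) earlier) last-gap)))
    where
    P : Gap → Bool
    P p = active (proj₁ p) (proj₂ p ++ R)
    f : Gap → Gap
    f p = (proj₁ p , proj₂ p ++ y ∷ [])
    earlier : length (filterᵇ P (map f (gaps L))) ≡ activeLeft L (y ∷ R)
    earlier = trans (cong length (filterᵇ-map P f (gaps L)))
      (trans (length-map f (filterᵇ (P ∘ f) (gaps L)))
             (cong length (filterᵇ-cong (P ∘ f) _ (gaps L) (λ p → cong (active (proj₁ p)) (++-assoc (proj₂ p) (y ∷ []) R)))))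
    last-gap : activeLeft L (y ∷ R) + length (filterᵇ P ((L ++ y ∷ [] , []) ∷ []))
               ≡ sucIf (active (L ++ y ∷ []) R) (activeLeft L (y ∷ R))
    last-gap with active (L ++ y ∷ []) R
    ... | true  = +-comm (activeLeft L (y ∷ R)) 1
    ... | false = +-identityʳ _

  module Recurrence (m : ℕ) where
    open ActiveUnderInsertion m
    open InsertMax m using (avoids-insert)

    leftOf : List ℕ → Gap → Gap
    leftOf R p = (proj₁ p , proj₂ p ++ m ∷ R)
    rightOf : List ℕ → Gap → Gap
    rightOf L p = (L ++ m ∷ proj₁ p , proj₂ p)

    activeDecreasing : List ℕ → Gap → Bool
    activeDecreasing L p = active (L ++ proj₁ p) (proj₂ p) ∧ decreasing (proj₂ p)

    prefix-bounded : ∀ {xs ys zs} → xs ++ ys ≡ zs → All (_< m) zs → All (_< m) xs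
    prefix-bounded {xs} e a = AllP.++⁻ˡ xs (subst (All (_< m)) (sym e) a)
    suffix-bounded : ∀ {xs ys zs} → xs ++ ys ≡ zs → All (_< m) zs → All (_< m) ys
    suffix-bounded {xs} e a = AllP.++⁻ʳ xs (subst (All (_< m)) (sym e) a)

    flags-left : ∀ L R k → All (_< m) L → All (_< m) R → active L R ≡ true → activeLeft L R ≡ suc k →
      map flag (filterᵇ activeGap (map (leftOf R) (gaps L))) ≡ leftFlags k (decreasing R)
    flags-left L R k aL aR hact hcnt = begin
        map flag (filterᵇ activeGap (map (leftOf R) (gaps L)))
      ≡⟨ cong (map flag) (filterᵇ-map activeGap (leftOf R) (gaps L)) ⟩
        map flag (map (leftOf R) (filterᵇ (activeGap ∘ leftOf R) (gaps L)))
      ≡⟨ cong (λ l → map flag (map (leftOf R) l)) (filterᵇ-congAll (activeGap ∘ leftOf R) stillActive (gaps-split L)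
           (λ p e → active-insertRight (proj₁ p) (proj₂ p) R (prefix-bounded e aL) (suffix-bounded e aL) aR)) ⟩
        map flag (map (leftOf R) (filterᵇ stillActive (gaps L)))
      ≡⟨ map-map flag (leftOf R) (filterᵇ stillActive (gaps L)) ⟩
        map (flag ∘ leftOf R) (filterᵇ stillActive (gaps L))
      ≡⟨ map-congAll (flag ∘ leftOf R) (λ p → (null (proj₁ p) , null (proj₂ p) ∧ decreasing R))
           (filterᵇ-All stillActive (gaps-split L))
           (λ p e → cong₂ _,_ (above-insertRight (proj₁ p) (proj₂ p) R (prefix-bounded e aL))
                              (decreasing-insert (proj₂ p) R (suffix-bounded e aL) aR)) ⟩
        map (λ p → (null (proj₁ p) , null (proj₂ p) ∧ decreasing R)) (filterᵇ stillActive (gaps L))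
      ≡⟨ leftFlags-correct L stillActive (decreasing R) k refl hact hcnt ⟩
        leftFlags k (decreasing R)
      ∎
      where
      open ≡-Reasoning
      stillActive : Gap → Bool
      stillActive p = active (proj₁ p) (proj₂ p ++ R)

    flagAfter : List ℕ → Gap → Flag
    flagAfter L p = (above (L ++ proj₁ p) (proj₂ p) , decreasing (proj₂ p))

    flags-right-raw : ∀ L R → All (_< m) L → All (_< m) R →
      map flag (filterᵇ activeGap (map (rightOf L) (gaps R)))
      ≡ map (flagAfter L) (filterᵇ (λ p → active (L ++ proj₁ p) (proj₂ p) ∧ (above L R ∧ decreasing (proj₂ p))) (gaps R))
    flags-right-raw L R aL aR =
      trans (cong (map flag) (filterᵇ-map activeGap (rightOf L) (gaps R)))
      (trans (cong (λ l → map flag (map (rightOf L) l)) (filterᵇ-congAll (activeGap ∘ rightOf L) _ (gaps-split R)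
                 (λ p e → trans (active-insertLeft L (proj₁ p) (proj₂ p) aL (prefix-bounded e aR) (suffix-bounded e aR))
                                (cong (λ w → active (L ++ proj₁ p) (proj₂ p) ∧ (above L w ∧ decreasing (proj₂ p))) e))))
      (trans (map-map flag (rightOf L) _)
      (map-congAll (flag ∘ rightOf L) (flagAfter L) (filterᵇ-All _ (gaps-split R))
        (λ p e → cong (_, decreasing (proj₂ p)) (above-insertLeft L (proj₁ p) (proj₂ p) (suffix-bounded e aR))))))

    surviving-flags : ∀ L R →
      map markDecreasing (filterᵇ proj₂ (map flag (filterᵇ activeGap (gapsFrom L R))))
      ≡ map (markDecreasing ∘ flagAfter L) (filterᵇ (activeDecreasing L) (gaps R))
    surviving-flags L R =
      trans (cong (λ l → map markDecreasing (filterᵇ proj₂ (map flag (filterᵇ activeGap l)))) (gapsFrom≡ L R))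
      (trans (cong (λ l → map markDecreasing (filterᵇ proj₂ (map flag l))) (filterᵇ-map activeGap shiftL (gaps R)))
      (trans (cong (λ l → map markDecreasing (filterᵇ proj₂ l)) (map-map flag shiftL (filterᵇ activeAfter (gaps R))))
      (trans (cong (map markDecreasing) (filterᵇ-map proj₂ (flagAfter L) (filterᵇ activeAfter (gaps R))))
      (trans (cong (λ l → map markDecreasing (map (flagAfter L) l)) (filterᵇ-filterᵇ activeAfter (decreasing ∘ proj₂) (gaps R)))
             (map-map markDecreasing (flagAfter L) (filterᵇ (activeDecreasing L) (gaps R)))))))
      where
      shiftL : Gap → Gap
      shiftL p = (L ++ proj₁ p , proj₂ p)
      activeAfter : Gap → Bool
      activeAfter p = active (L ++ proj₁ p) (proj₂ p)

    flags-right : ∀ L R → All (_< m) L → All (_< m) R →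
      map flag (filterᵇ activeGap (map (rightOf L) (gaps R)))
      ≡ (if above L R then map markDecreasing (filterᵇ proj₂ (map flag (filterᵇ activeGap (gapsFrom L R)))) else [])
    flags-right L R aL aR with above L R in ec
    ... | true  = trans (flags-right-raw L R aL aR)
      (trans (cong (map (flagAfter L)) (filterᵇ-cong _ (activeDecreasing L) (gaps R) (λ p → cong (λ c → active (L ++ proj₁ p) (proj₂ p) ∧ (c ∧ decreasing (proj₂ p))) ec)))
      (trans (map-congAll (flagAfter L) (markDecreasing ∘ flagAfter L) (filterᵇ-true (activeDecreasing L) (gaps R))
               (λ p e → cong (above (L ++ proj₁ p) (proj₂ p) ,_) (proj₂ (∧-split _ _ e))))
             (sym (surviving-flags L R))))
    ... | false = trans (flags-right-raw L R aL aR) (cong (map (flagAfter L))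
      (trans (filterᵇ-cong _ _ (gaps R) (λ p → cong (λ c → active (L ++ proj₁ p) (proj₂ p) ∧ (c ∧ decreasing (proj₂ p))) ec))
             (filterᵇ-none _ (gaps R) (λ p → ∧-zeroʳ (active (L ++ proj₁ p) (proj₂ p))))))

    label-insert : ∀ L R k → All (_< m) L → All (_< m) R → active L R ≡ true → activeLeft L R ≡ suc k →
      label (L ++ m ∷ R) ≡ leftFlags k (decreasing R)
        ++ (if above L R then map markDecreasing (filterᵇ proj₂ (map flag (filterᵇ activeGap (gapsFrom L R)))) else [])
    label-insert L R k aL aR hact hcnt =
      trans (cong (map flag ∘ filterᵇ activeGap) (gaps-insert m L R))
      (trans (cong (map flag) (filterᵇ-++ activeGap (map (leftOf R) (gaps L)) (map (rightOf L) (gaps R))))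
      (trans (map-++ flag (filterᵇ activeGap (map (leftOf R) (gaps L))) (filterᵇ activeGap (map (rightOf L) (gaps R))))
             (cong₂ _++_ (flags-left L R k aL aR hact hcnt) (flags-right L R aL aR))))

    label-insert′ : ∀ L R k → All (_< m) L → All (_< m) R → active L R ≡ true → activeLeft L R ≡ suc k →
      (post : List Flag) → map flag (filterᵇ activeGap (gapsFrom L R)) ≡ flag (L , R) ∷ post →
      label (L ++ m ∷ R) ≡ childLabel k (flag (L , R)) post
    label-insert′ L R k aL aR ha hc post ep = trans (label-insert L R k aL aR ha hc)
      (cong (λ l → leftFlags k (decreasing R) ++ (if above L R then map markDecreasing (filterᵇ proj₂ l) else [])) ep)

    childLabelsFrom-correct : ∀ R L k → All (_< m) L → All (_< m) R → activeLeft L R ≡ sucIf (active L R) k →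
      childLabelsFrom k (map flag (filterᵇ activeGap (gapsFrom L R)))
      ≡ map (λ g → label (insertAt m g)) (filterᵇ activeGap (gapsFrom L R))
    childLabelsFrom-correct [] L k aL aR hc with active L [] in ea
    ... | false = refl
    ... | true = cong (_∷ []) (sym (label-insert′ L [] k aL aR ea hc [] (cong (map flag) (filterᵇ-accept activeGap {L , []} [] ea))))
    childLabelsFrom-correct (y ∷ R) L k aL (ay ∷ aR) hc with active L (y ∷ R) in ea
    ... | false = childLabelsFrom-correct R (L ++ y ∷ []) k (AllP.++⁺ aL (ay ∷ [])) aR
                    (trans (activeLeft-snoc L y R) (cong (sucIf (active (L ++ y ∷ []) R)) hc))
    ... | true = cong₂ _∷_
          (sym (label-insert′ L (y ∷ R) k aL (ay ∷ aR) ea hc (map flag (filterᵇ activeGap (gapsFrom (L ++ y ∷ []) R)))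
               (cong (map flag) (filterᵇ-accept activeGap {L , y ∷ R} (gapsFrom (L ++ y ∷ []) R) ea))))
          (childLabelsFrom-correct R (L ++ y ∷ []) (suc k) (AllP.++⁺ aL (ay ∷ [])) aR
             (trans (activeLeft-snoc L y R) (cong (sucIf (active (L ++ y ∷ []) R)) hc)))

    avoids-insertAt : ∀ σ → All (_< m) σ →
      filterᵇ (avoids ∘ insertAt m) (gaps σ) ≡ filterᵇ (λ p → avoids σ ∧ activeGap p) (gaps σ)
    avoids-insertAt σ aσ = filterᵇ-congAll (avoids ∘ insertAt m) _ (gaps-split σ) (λ p e →
      trans (avoids-insert (proj₁ p) (proj₂ p) (prefix-bounded e aσ) (suffix-bounded e aσ))
            (cong (λ τ → avoids τ ∧ activeGap p) e))

    children-labels : ∀ σ → All (_< m) σ → avoids σ ≡ true →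
      map label (filterᵇ avoids (insertions m σ)) ≡ childLabels (label σ)
    children-labels σ aσ hav = begin
        map label (filterᵇ avoids (insertions m σ))
      ≡⟨ cong (λ l → map label (filterᵇ avoids l)) (insertions≡gaps m σ) ⟩
        map label (filterᵇ avoids (map (insertAt m) (gaps σ)))
      ≡⟨ cong (map label) (filterᵇ-map avoids (insertAt m) (gaps σ)) ⟩
        map label (map (insertAt m) (filterᵇ (avoids ∘ insertAt m) (gaps σ)))
      ≡⟨ cong (λ l → map label (map (insertAt m) l)) (trans (avoids-insertAt σ aσ)
                (cong (λ b → filterᵇ (λ p → b ∧ activeGap p) (gaps σ)) hav)) ⟩
        map label (map (insertAt m) (filterᵇ activeGap (gaps σ)))
      ≡⟨ map-map label (insertAt m) (filterᵇ activeGap (gaps σ)) ⟩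
        map (λ g → label (insertAt m g)) (filterᵇ activeGap (gaps σ))
      ≡⟨ cong (λ l → map (λ g → label (insertAt m g)) (filterᵇ activeGap l)) (gaps≡gapsFrom σ) ⟩
        map (λ g → label (insertAt m g)) (filterᵇ activeGap (gapsFrom [] σ))
      ≡⟨ childLabelsFrom-correct σ [] 0 [] aσ refl ⟨
        childLabelsFrom 0 (map flag (filterᵇ activeGap (gapsFrom [] σ)))
      ≡⟨ cong (λ l → childLabelsFrom 0 (map flag (filterᵇ activeGap l))) (gaps≡gapsFrom σ) ⟨
        childLabels (label σ)
      ∎
      where open ≡-Reasoning

    no-children : ∀ σ → All (_< m) σ → avoids σ ≡ false → filterᵇ avoids (insertions m σ) ≡ []
    no-children σ aσ hav =
      trans (cong (filterᵇ avoids) (insertions≡gaps m σ))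
      (trans (filterᵇ-map avoids (insertAt m) (gaps σ))
      (cong (map (insertAt m)) (trans (avoids-insertAt σ aσ)
        (filterᵇ-none _ (gaps σ) (λ p → cong (_∧ activeGap p) hav)))))

-- Every label that occurs is the image under
-- stateLabel of a state of the generating tree, and childLabels corresponds
-- to children; so the labels of the avoiders of length n are the images of
-- the nodes on level n, and |S_n(T)| is the size of that level.
module LabelsAreTreeStates where

  open import Data.Nat using (zero; suc; _<_; _+_)
  open import Data.Nat.Properties using (+-identityʳ; +-suc; n<1+n; m<n⇒m<1+n)
  open import Data.Bool using (true; false)
  open import Data.Product using (_,_; proj₂)
  open import Data.List using (_++_; map; length; concatMap; filterᵇ; replicate)
  open import Data.List.Properties using (map-++; ++-assoc; ++-identityʳ; length-map)
  open import Data.List.Relation.Unary.All as All using (All; []; _∷_)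
  import Data.List.Relation.Unary.All.Properties as AllP
  open import Relation.Binary.PropositionalEquality
  open MaxInsertion using (patterns)
  open ListFacts
  open Gaps
  open Labels
  open LabelRecurrence
  open GeneratingTree using (State; sA; sP; sQ; children; qRun; pRun)
  open TreeLevels using (level; grow-suc)

  AD NN AN ND : Flag
  AD = (true , true)
  NN = (false , false)
  AN = (true , false)
  ND = (false , true)

  stateLabel : State → List Flag
  stateLabel (sA j)   = AD ∷ replicate j AD
  stateLabel (sP a b) = AN ∷ (replicate a NN ++ ND ∷ replicate b AD)
  stateLabel (sQ a)   = AN ∷ replicate a NN

  leftFlags′-false : ∀ k → leftFlags′ k false ≡ replicate (suc k) NN
  leftFlags′-false zero    = refl
  leftFlags′-false (suc k) = cong (NN ∷_) (leftFlags′-false k)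

  leftFlags′-true : ∀ k → leftFlags′ k true ≡ replicate k NN ++ ND ∷ []
  leftFlags′-true zero    = refl
  leftFlags′-true (suc k) = cong (NN ∷_) (leftFlags′-true k)

  decreasing-NN : ∀ r Z → filterᵇ proj₂ (replicate r NN ++ Z) ≡ filterᵇ proj₂ Z
  decreasing-NN zero    Z = refl
  decreasing-NN (suc r) Z = decreasing-NN r Z

  decreasing-AD : ∀ r → map markDecreasing (filterᵇ proj₂ (replicate r AD)) ≡ replicate r AD
  decreasing-AD zero    = refl
  decreasing-AD (suc r) = cong (AD ∷_) (decreasing-AD r)

  childLabels-NN : ∀ k r Z → childLabelsFrom (suc k) (replicate r NN ++ Z)
                             ≡ map stateLabel (qRun (suc k) r) ++ childLabelsFrom (suc k + r) Z
  childLabels-NN k zero    Z = cong (λ i → childLabelsFrom i Z) (sym (+-identityʳ (suc k)))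
  childLabels-NN k (suc r) Z = cong₂ _∷_
    (trans (++-identityʳ _) (cong (AN ∷_) (leftFlags′-false k)))
    (trans (childLabels-NN (suc k) r Z)
           (cong (λ i → map stateLabel (qRun (suc (suc k)) r) ++ childLabelsFrom i Z) (sym (+-suc (suc k) r))))

  childLabels-AD : ∀ k r → childLabelsFrom (suc k) (replicate r AD) ≡ map stateLabel (pRun k r)
  childLabels-AD k zero    = refl
  childLabels-AD k (suc r) = cong₂ _∷_
    (cong (AN ∷_) (trans (cong₂ (λ u v → u ++ AD ∷ v) (leftFlags′-true k) (decreasing-AD r))
                         (++-assoc (replicate k NN) (ND ∷ []) (AD ∷ replicate r AD))))
    (childLabels-AD (suc k) r)

  childLabels-stateLabel : ∀ s → childLabels (stateLabel s) ≡ map stateLabel (children s)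
  childLabels-stateLabel (sA j)   = cong₂ _∷_ (cong (λ l → AD ∷ AD ∷ l) (decreasing-AD j)) (childLabels-AD 0 j)
  childLabels-stateLabel (sP a b) = cong₂ _∷_
    (cong (AN ∷_) (trans (cong (map markDecreasing) (decreasing-NN a (ND ∷ replicate b AD))) (cong (ND ∷_) (decreasing-AD b))))
    (trans (childLabels-NN 0 a (ND ∷ replicate b AD))
    (trans (cong (map stateLabel (qRun 1 a) ++_)
                 (cong₂ _∷_ (trans (++-identityʳ _) (cong (AN ∷_) (leftFlags′-true a))) (childLabels-AD (suc a) b)))
           (sym (map-++ stateLabel (qRun 1 a) (sP a 0 ∷ pRun (suc a) b)))))
  childLabels-stateLabel (sQ a)   = cong₂ _∷_
    (cong (λ l → AN ∷ map markDecreasing l) (trans (cong (filterᵇ proj₂) (sym (++-identityʳ (replicate a NN))))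
                                                   (decreasing-NN a [])))
    (trans (cong (childLabelsFrom 1) (sym (++-identityʳ (replicate a NN))))
    (trans (childLabels-NN 0 a []) (++-identityʳ _)))

  childLabels-concat : ∀ (l : List State) → concatMap childLabels (map stateLabel l) ≡ map stateLabel (concatMap children l)
  childLabels-concat []      = refl
  childLabels-concat (s ∷ l) = trans (cong₂ _++_ (childLabels-stateLabel s) (childLabels-concat l))
                                     (sym (map-++ stateLabel (children s) (concatMap children l)))

  insertions-bounded : ∀ x σ k → All (_< k) σ → x < k → All (All (_< k)) (insertions x σ)
  insertions-bounded x []       k a        hx = (hx ∷ []) ∷ []
  insertions-bounded x (y ∷ ys) k (hy ∷ a) hx =
    (hx ∷ hy ∷ a) ∷ AllP.map⁺ (All.map (hy ∷_) (insertions-bounded x ys k a hx))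

  perms-bounded : ∀ n → All (All (_< suc n)) (perms n)
  perms-bounded zero    = [] ∷ []
  perms-bounded (suc n) = AllP.concat⁺ (AllP.map⁺ (All.map
    (λ {σ} a → insertions-bounded (suc n) σ (suc (suc n)) (All.map m<n⇒m<1+n a) (n<1+n (suc n))) (perms-bounded n)))

  labels-++ : ∀ m x xs → map label (filterᵇ avoids (concatMap (insertions m) (x ∷ xs)))
                         ≡ map label (filterᵇ avoids (insertions m x)) ++ map label (filterᵇ avoids (concatMap (insertions m) xs))
  labels-++ m x xs = trans (cong (map label) (filterᵇ-++ avoids (insertions m x) (concatMap (insertions m) xs)))
                           (map-++ label (filterᵇ avoids (insertions m x)) (filterᵇ avoids (concatMap (insertions m) xs)))

  labels-step : ∀ m (xs : List (List ℕ)) → All (All (_< m)) xs →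
    map label (filterᵇ avoids (concatMap (insertions m) xs)) ≡ concatMap childLabels (map label (filterᵇ avoids xs))
  labels-step m []       []       = refl
  labels-step m (x ∷ xs) (a ∷ as) with avoids x in e
  ... | true  = trans (labels-++ m x xs) (cong₂ _++_ (children-labels x a e) (labels-step m xs as))
    where open Recurrence m using (children-labels)
  ... | false = trans (labels-++ m x xs) (cong₂ (λ l r → map label l ++ r) (no-children x a e) (labels-step m xs as))
    where open Recurrence m using (no-children)

  labels-level : ∀ n → map label (filterᵇ avoids (perms n)) ≡ map stateLabel (level n)
  labels-level zero    = refl
  labels-level (suc n) = trans (labels-step (suc n) (perms n) (perms-bounded n))
    (trans (cong (concatMap childLabels) (labels-level n))
    (trans (childLabels-concat (level n)) (cong (map stateLabel) (sym (grow-suc n (sA 0 ∷ []))))))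

  count≡level : ∀ n → countAvoiders patterns n ≡ length (level n)
  count≡level n = trans (sym (length-map label (filterᵇ avoids (perms n))))
    (trans (cong length (labels-level n)) (length-map stateLabel (level n)))

open import Relation.Binary.PropositionalEquality using (trans; sym; cong)
open PowerSeries using (_≈_; _⊛_; ⊛-cong)
open SeriesToolkit using (·ₛ-is-⊛; coeff-poly)
open ClosedForm using (denominatorPoly; denominatorPoly-series; numerator; root-closed-form)
open MaxInsertion using (patterns)

F≈root : F patterns ≈ GeneratingTree.gf (GeneratingTree.sA 0)
F≈root n = trans (cong +_ (LabelsAreTreeStates.count≡level n)) (TreeLevels.level-counted n)

mainTheorem18 :
    (n : ℕ) →
    (((((((+ 1 ∷ - (+ 1) ∷ []) ·ₚ (+ 1 ∷ - (+ 1) ∷ [])) ·ₚ (+ 1 ∷ - (+ 1) ∷ []))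
        ·ₚ (+ 1 ∷ - (+ 2) ∷ [])) ·ₚ (+ 1 ∷ - (+ 3) ∷ []))
        ·ₚ (+ 1 ∷ - (+ 3) ∷ + 1 ∷ []))
      ·ₛ F ((1 ∷ 3 ∷ 2 ∷ 4 ∷ []) ∷ (1 ∷ 3 ∷ 4 ∷ 2 ∷ []) ∷ (3 ∷ 4 ∷ 1 ∷ 2 ∷ []) ∷ [])) n
    ≡ coeff (+ 1 ∷ - (+ 10) ∷ + 40 ∷ - (+ 81) ∷ + 88 ∷ - (+ 50) ∷ + 11 ∷ []) n
mainTheorem18 n = begin
    (denominatorPoly ·ₛ F patterns) n
  ≡⟨ ·ₛ-is-⊛ denominatorPoly (F patterns) n ⟩
    (coeff denominatorPoly ⊛ F patterns) n
  ≡⟨ ⊛-cong (λ k → trans (coeff-poly denominatorPoly k) (denominatorPoly-series k)) F≈root n ⟩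
    (ClosedForm.denominator ⊛ GeneratingTree.gf (GeneratingTree.sA 0)) n
  ≡⟨ root-closed-form n ⟩
    SeriesToolkit.poly numerator n
  ≡⟨ coeff-poly numerator n ⟨
    coeff numerator n
  ∎
  where open Relation.Binary.PropositionalEquality.≡-Reasoning
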